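{- If $\varphi$ is a partial edge coloring of at most $4$ edges of $K_5 \square K_2$ using colors from $\{1,\dots,6\}$, then $\varphi$ is extendable to a proper $6$-edge coloring of $K_5 \square K_2$.
   Context: $G \square H$ denotes the cartesian product of graphs $G$ and $H$. A partial edge coloring of a graph is a proper edge coloring of some subset of its edges. A partial coloring $\varphi$ is extendable to a proper $t$-edge coloring if there is a proper edge coloring $f$ with colors $\{1,\dots,t\}$ such that $f(e)=\varphi(e)$ for every edge $e$ colored under $\varphi$. -}

module Defs where

open import Data.Nat using (ℕ; _≤_)
open import Data.Fin using (Fin; _<_)
open import Data.Product using (Σ; _×_; _,_; proj₁; proj₂)
open import Data.Sum using (_⊎_)
open import Data.Maybe using (Maybe; just; nothing)
open import Data.List using (List; length; filter)
open import Data.Fin.Subset using (Subset; ∣_∣)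
open import Relation.Binary.PropositionalEquality using (_≡_; _≢_)
open import Relation.Nullary using (¬_)
open import Data.Empty using (⊥)

Vertex : Set
Vertex = Fin 5 × Fin 2

Adj : Vertex → Vertex → Set
Adj (i , a) (j , b) = (a ≡ b × i ≢ j) ⊎ (i ≡ j × a ≢ b)

_<ᵥ_ : Vertex → Vertex → Set
(i , a) <ᵥ (j , b) = (i < j) ⊎ (i ≡ j × a < b)

-- An edge is an unordered pair {u , v} of adjacent vertices, represented uniquely
-- by its ordered pair with u <ᵥ v.
record Edge : Set where
  constructor edge
  field
    u v  : Vertex
    u<v  : u <ᵥ v
    adj  : Adj u v
open Edge public

SameEdge : Edge → Edge → Set
SameEdge e f = u e ≡ u f × v e ≡ v f

Incident : Edge → Edge → Set
Incident e f = u e ≡ u f ⊎ u e ≡ v f ⊎ v e ≡ u f ⊎ v e ≡ v f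

Color : Set
Color = Fin 6

PartialColoring : Set
PartialColoring = Edge → Maybe Color

-- Well-defined on edges (depends only on endpoints) and proper on coloured edges:
-- distinct incident coloured edges get distinct colours.
IsProperPartial : PartialColoring → Set
IsProperPartial φ =
  (∀ e f → SameEdge e f → φ e ≡ φ f) ×
  (∀ e f c → ¬ SameEdge e f → Incident e f → φ e ≡ just c → φ f ≡ just c → ⊥)

-- The set of coloured edges has at most k elements: any duplicate-free list
-- of coloured edges has length ≤ k.
open import Data.List.Relation.Unary.AllPairs using (AllPairs)
open import Data.List.Relation.Unary.All using (All)

AtMostColored : ℕ → PartialColoring → Set
AtMostColored k φ =
  (es : List Edge) → AllPairs (λ e f → ¬ SameEdge e f) es →
  All (λ e → Σ Color (λ c → φ e ≡ just c)) es → length es ≤ k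

TotalColoring : Set
TotalColoring = Edge → Color

IsProperTotal : TotalColoring → Set
IsProperTotal f =
  (∀ e e' → SameEdge e e' → f e ≡ f e') ×
  (∀ e e' → ¬ SameEdge e e' → Incident e e' → f e ≢ f e')

Extends : TotalColoring → PartialColoring → Set
Extends f φ = ∀ e c → φ e ≡ just c → f e ≡ c

Extendable : PartialColoring → Set
Extendable φ = Σ TotalColoring (λ f → IsProperTotal f × Extends f φ)

-- Permuting the colors of a proper edge coloring keeps it proper. Hence a precoloring of at
-- most four edges extends as soon as some proper 6-edge-coloring of K₅ □ K₂ has the same pattern
-- of equal and distinct colors on the precolored edges: a permutation of the colors then turns
-- that pattern into the prescribed colors. Listing the precolored edges as a nondecreasing
-- quadruple of edge indices (repeating one if there are fewer than four), it remains to find,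
-- for every such quadruple and every pattern admissible on it (equal colors on equal edges,
-- distinct colors on incident ones), a coloring realizing it. A catalog of 196 proper
-- colorings does, as is checked by evaluation.
module Submission where

open import Defs
open import Data.Bool using (Bool; true; false; T; not; _∧_; _∨_)
open import Data.Bool.ListAction using (all; any)
open import Data.Bool.Properties using (T-≡; T-∧)
open import Data.Fin using (Fin; zero; suc; toℕ; _≤_; _<_)
open import Data.Fin.Patterns using (0F; 1F; 2F; 3F; 4F; 5F)
open import Data.Fin.Permutation using (Permutation′; _⟨$⟩ʳ_; _⟨$⟩ˡ_; inverseˡ; id; transpose; _∘ₚ_)
open import Data.Fin.Properties using (_≟_; _<?_; all?; any?; <⇒≢; ≤-refl)
open import Data.List as List using (List; []; _∷_; length; filter; allFin)
open import Data.List.Membership.Propositional using (_∈_; find; lose)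
open import Data.List.Membership.Propositional.Properties using (∈-allFin; ∈-filter⁺; ∈-filter⁻; ∈-map⁺)
open import Data.List.Properties using (length-map)
open import Data.List.Relation.Unary.All as All using (All; []; _∷_)
import Data.List.Relation.Unary.All.Properties as All
open import Data.List.Relation.Unary.AllPairs using (AllPairs; []; _∷_)
import Data.List.Relation.Unary.AllPairs as AllPairs
import Data.List.Relation.Unary.AllPairs.Properties as AllPairs
open import Data.List.Relation.Unary.Any using (here; there)
import Data.List.Relation.Unary.Any as Any
open import Data.List.Relation.Unary.Any.Properties using (any⁻)
import Data.List.Relation.Unary.Any.Properties as Any
open import Data.Maybe using (just; nothing; fromMaybe)
open import Data.Nat as ℕ using (ℕ; s≤s)
import Data.Nat.Properties as ℕ
open import Data.Product using (Σ; ∃; _×_; _,_; proj₁; proj₂; uncurry)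
open import Data.Product.Properties using (≡-dec)
import Data.Sum as Sum
open import Data.Unit using (tt)
open import Data.Vec as Vec using (Vec; []; _∷_; lookup; tabulate)
open import Data.Vec.Properties using (lookup-map; lookup∘tabulate)
import Data.Vec.Membership.Propositional as Vec
import Data.Vec.Relation.Unary.All as VecAll
open import Data.Vec.Relation.Unary.All using ([]; _∷_)
open import Data.Vec.Relation.Unary.All.Properties using (lookup⁺)
open import Data.Vec.Relation.Unary.Any using (here; there)
import Data.Vec.Relation.Unary.Any as VecAny
open import Data.Vec.Relation.Unary.Any.Properties using (lookup-index)
open import Function using (_∘_; _⇔_; mk⇔; Equivalence)
open import Relation.Binary.Definitions using (DecidableEquality; Decidable)
open import Relation.Binary.PropositionalEquality
  using (_≡_; _≢_; refl; sym; trans; cong; cong₂; subst; module ≡-Reasoning)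
open import Relation.Nullary using (yes; no; ¬_; ¬?; contradiction)
open import Relation.Nullary.Decidable using (T?; _×-dec_; _⊎-dec_; _→-dec_; from-yes; dec-true; dec-false)
import Relation.Unary as Unary

open ≡-Reasoning

private
  variable
    m n : ℕ
    A B : Set

-- Equality patterns and relabeling

SamePattern : Vec A n → Vec B n → Set
SamePattern xs ys =
  ∀ i j → (lookup xs i ≡ lookup xs j → lookup ys i ≡ lookup ys j)
        × (lookup ys i ≡ lookup ys j → lookup xs i ≡ lookup xs j)

permutation-injective : (π : Permutation′ n) {x y : Fin n} → π ⟨$⟩ʳ x ≡ π ⟨$⟩ʳ y → x ≡ y
permutation-injective π eq = trans (sym (inverseˡ π)) (trans (cong (π ⟨$⟩ˡ_) eq) (inverseˡ π))

transpose-sends : (i j : Fin n) → transpose i j ⟨$⟩ʳ i ≡ j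
transpose-sends i j rewrite dec-true (i ≟ i) refl = refl

transpose-fixes : {i j k : Fin n} → k ≢ i → k ≢ j → transpose i j ⟨$⟩ʳ k ≡ k
transpose-fixes {i = i} {j} {k} k≢i k≢j
  rewrite dec-false (k ≟ i) k≢i | dec-false (k ≟ j) k≢j = refl

samePattern⇒relabeling : (xs ys : Vec (Fin m) n) → SamePattern xs ys →
                          ∃ λ (π : Permutation′ m) → ∀ i → π ⟨$⟩ʳ lookup xs i ≡ lookup ys i
samePattern⇒relabeling [] [] _ = id , λ ()
samePattern⇒relabeling (x ∷ xs) (y ∷ ys) same
  with samePattern⇒relabeling xs ys (λ i j → same (suc i) (suc j))
... | σ , σ-maps with σ ⟨$⟩ʳ x ≟ y
...   | yes σx≡y = σ , λ { zero → σx≡y ; (suc i) → σ-maps i }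
...   | no  σx≢y = σ ∘ₚ τ , λ { zero → transpose-sends (σ ⟨$⟩ʳ x) y ; (suc i) → τ-maps i }
  where
  τ : Permutation′ _
  τ = transpose (σ ⟨$⟩ʳ x) y

  -- ys i differs from y (else xs i = x and σ x = y) and from σ x (else xs i = x by injectivity).
  τ-maps : ∀ i → τ ⟨$⟩ʳ (σ ⟨$⟩ʳ lookup xs i) ≡ lookup ys i
  τ-maps i = trans (cong (τ ⟨$⟩ʳ_) (σ-maps i)) (transpose-fixes ysᵢ≢σx ysᵢ≢y)
    where
    ysᵢ≢y : lookup ys i ≢ y
    ysᵢ≢y ysᵢ≡y = σx≢y (trans (cong (σ ⟨$⟩ʳ_) (sym (proj₂ (same (suc i) zero) ysᵢ≡y)))
                              (trans (σ-maps i) ysᵢ≡y))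
    ysᵢ≢σx : lookup ys i ≢ σ ⟨$⟩ʳ x
    ysᵢ≢σx ysᵢ≡σx =
      ysᵢ≢y (proj₁ (same (suc i) zero) (permutation-injective σ (trans (σ-maps i) ysᵢ≡σx)))

-- The edges of K₅ □ K₂

_≟ᵥ_ : DecidableEquality Vertex
_≟ᵥ_ = ≡-dec _≟_ _≟_

_≟ₑ_ : DecidableEquality (Vertex × Vertex)
_≟ₑ_ = ≡-dec _≟ᵥ_ _≟ᵥ_

_<ᵥ?_ : Decidable _<ᵥ_
(i , a) <ᵥ? (j , b) = i <? j ⊎-dec (i ≟ j ×-dec a <? b)

adjacent? : Decidable Adj
adjacent? (i , a) (j , b) = (a ≟ b ×-dec ¬? (i ≟ j)) ⊎-dec (i ≟ j ×-dec ¬? (a ≟ b))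

incident? : Decidable Incident
incident? e f = u e ≟ᵥ u f ⊎-dec u e ≟ᵥ v f ⊎-dec v e ≟ᵥ u f ⊎-dec v e ≟ᵥ v f

-- The 25 edges in lexicographic order of their endpoints; a coloring indexed by Fin 25 gives
-- edge k its k-th entry.
edgeTable : Vec (Vertex × Vertex) 25
edgeTable =
  ((0F , 0F) , (0F , 1F))
  ∷ ((0F , 0F) , (1F , 0F))
  ∷ ((0F , 0F) , (2F , 0F))
  ∷ ((0F , 0F) , (3F , 0F))
  ∷ ((0F , 0F) , (4F , 0F))
  ∷ ((0F , 1F) , (1F , 1F))
  ∷ ((0F , 1F) , (2F , 1F))
  ∷ ((0F , 1F) , (3F , 1F))
  ∷ ((0F , 1F) , (4F , 1F))
  ∷ ((1F , 0F) , (1F , 1F))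
  ∷ ((1F , 0F) , (2F , 0F))
  ∷ ((1F , 0F) , (3F , 0F))
  ∷ ((1F , 0F) , (4F , 0F))
  ∷ ((1F , 1F) , (2F , 1F))
  ∷ ((1F , 1F) , (3F , 1F))
  ∷ ((1F , 1F) , (4F , 1F))
  ∷ ((2F , 0F) , (2F , 1F))
  ∷ ((2F , 0F) , (3F , 0F))
  ∷ ((2F , 0F) , (4F , 0F))
  ∷ ((2F , 1F) , (3F , 1F))
  ∷ ((2F , 1F) , (4F , 1F))
  ∷ ((3F , 0F) , (3F , 1F))
  ∷ ((3F , 0F) , (4F , 0F))
  ∷ ((3F , 1F) , (4F , 1F))
  ∷ ((4F , 0F) , (4F , 1F))
  ∷ []

endpoint₁ endpoint₂ : Fin 25 → Vertex
endpoint₁ k = proj₁ (lookup edgeTable k)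
endpoint₂ k = proj₂ (lookup edgeTable k)

opaque
  edgeTable-edges : ∀ k → endpoint₁ k <ᵥ endpoint₂ k × Adj (endpoint₁ k) (endpoint₂ k)
  edgeTable-edges = from-yes (all? λ k →
    endpoint₁ k <ᵥ? endpoint₂ k ×-dec adjacent? (endpoint₁ k) (endpoint₂ k))

  edgeTable-complete : ∀ i a j b → (i , a) <ᵥ (j , b) → Adj (i , a) (j , b) →
                       ∃ λ k → lookup edgeTable k ≡ ((i , a) , (j , b))
  edgeTable-complete = from-yes (all? λ i → all? λ a → all? λ j → all? λ b →
    (i , a) <ᵥ? (j , b) →-dec adjacent? (i , a) (j , b) →-dec
    any? λ k → lookup edgeTable k ≟ₑ ((i , a) , (j , b)))

  edgeTable-injective : ∀ k l → lookup edgeTable k ≡ lookup edgeTable l → k ≡ l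
  edgeTable-injective = from-yes (all? λ k → all? λ l →
    lookup edgeTable k ≟ₑ lookup edgeTable l →-dec k ≟ l)

edgeAt : Fin 25 → Edge
edgeAt k = edge (endpoint₁ k) (endpoint₂ k) (proj₁ (edgeTable-edges k)) (proj₂ (edgeTable-edges k))

indexOf : Edge → Fin 25
indexOf (edge (i , a) (j , b) u<v adj) = proj₁ (edgeTable-complete i a j b u<v adj)

endpoints : Edge → Vertex × Vertex
endpoints e = u e , v e

lookup-indexOf : ∀ e → lookup edgeTable (indexOf e) ≡ endpoints e
lookup-indexOf (edge (i , a) (j , b) u<v adj) = proj₂ (edgeTable-complete i a j b u<v adj)

sameEdge⇔endpoints : ∀ e f → SameEdge e f ⇔ (endpoints e ≡ endpoints f)
sameEdge⇔endpoints e f = mk⇔ (λ (p , q) → cong₂ _,_ p q) (λ eq → cong proj₁ eq , cong proj₂ eq)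

edgeAt-indexOf : ∀ e → SameEdge (edgeAt (indexOf e)) e
edgeAt-indexOf e = Equivalence.from (sameEdge⇔endpoints (edgeAt (indexOf e)) e) (lookup-indexOf e)

indexOf-cong : ∀ {e f} → SameEdge e f → indexOf e ≡ indexOf f
indexOf-cong {e} {f} same = edgeTable-injective _ _ (begin
  lookup edgeTable (indexOf e)  ≡⟨ lookup-indexOf e ⟩
  endpoints e                   ≡⟨ Equivalence.to (sameEdge⇔endpoints e f) same ⟩
  endpoints f                   ≡⟨ lookup-indexOf f ⟨
  lookup edgeTable (indexOf f)  ∎)

indexOf-injective : ∀ {e f} → indexOf e ≡ indexOf f → SameEdge e f
indexOf-injective {e} {f} eq = Equivalence.from (sameEdge⇔endpoints e f) (begin
  endpoints e                   ≡⟨ lookup-indexOf e ⟨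
  lookup edgeTable (indexOf e)  ≡⟨ cong (lookup edgeTable) eq ⟩
  lookup edgeTable (indexOf f)  ≡⟨ lookup-indexOf f ⟩
  endpoints f                   ∎)

edgeAt-injective : ∀ {k l} → k ≢ l → ¬ SameEdge (edgeAt k) (edgeAt l)
edgeAt-injective {k} {l} k≢l same =
  k≢l (edgeTable-injective k l (Equivalence.to (sameEdge⇔endpoints (edgeAt k) (edgeAt l)) same))

incident-indexOf : ∀ {e f} → Incident e f → Incident (edgeAt (indexOf e)) (edgeAt (indexOf f))
incident-indexOf {e} {f} incident with edgeAt-indexOf e | edgeAt-indexOf f
... | p , q | p′ , q′ =
  Sum.map (λ uu → trans p (trans uu (sym p′))) (Sum.map (λ uv → trans p (trans uv (sym q′)))
    (Sum.map (λ vu → trans q (trans vu (sym p′))) (λ vv → trans q (trans vv (sym q′))))) incident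

Conflict : Fin 25 → Fin 25 → Set
Conflict k l = k ≢ l × Incident (edgeAt k) (edgeAt l)

conflict? : Decidable Conflict
conflict? k l = ¬? (k ≟ l) ×-dec incident? (edgeAt k) (edgeAt l)

IsProperIndexColoring : (Fin 25 → A) → Set
IsProperIndexColoring g = ∀ k l → Conflict k l → g k ≢ g l

properIndexColoring⇒properTotal : {g : Fin 25 → Color} → IsProperIndexColoring g →
                                  IsProperTotal (g ∘ indexOf)
properIndexColoring⇒properTotal {g} proper =
  (λ e f → cong g ∘ indexOf-cong) ,
  (λ e f ¬same incident →
    proper (indexOf e) (indexOf f) (¬same ∘ indexOf-injective , incident-indexOf incident))

Admissible : Vec (Fin 25) n → Vec A n → Set
Admissible ks cs = ∀ i j → (lookup ks i ≡ lookup ks j → lookup cs i ≡ lookup cs j)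
                         × (Conflict (lookup ks i) (lookup ks j) → lookup cs i ≢ lookup cs j)

Nondecreasing : Vec (Fin m) 4 → Set
Nondecreasing (k₁ ∷ k₂ ∷ k₃ ∷ k₄ ∷ []) = k₁ ≤ k₂ × k₂ ≤ k₃ × k₃ ≤ k₄

-- The exhaustive checks are stated with these rather than with decision procedures, whose
-- evaluation is several times slower.

_≡ᵇ_ : Fin n → Fin n → Bool
zero  ≡ᵇ zero  = true
suc x ≡ᵇ suc y = x ≡ᵇ y
_     ≡ᵇ _     = false

≡ᵇ⇒≡ : {x y : Fin n} → T (x ≡ᵇ y) → x ≡ y
≡ᵇ⇒≡ {x = zero}  {zero}  _ = refl
≡ᵇ⇒≡ {x = suc x} {suc y} t = cong suc (≡ᵇ⇒≡ t)

≡⇒≡ᵇ : {x y : Fin n} → x ≡ y → T (x ≡ᵇ y)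
≡⇒≡ᵇ {x = zero}  refl = tt
≡⇒≡ᵇ {x = suc x} refl = ≡⇒≡ᵇ {x = x} refl

≡ᵇ-false⇒≢ : {x y : Fin n} → T (not (x ≡ᵇ y)) → x ≢ y
≡ᵇ-false⇒≢ {x = x} different refl with x ≡ᵇ x | ≡⇒≡ᵇ {x = x} refl
... | true | _ = different

≢⇒≡ᵇ-false : {x y : Fin n} → x ≢ y → T (not (x ≡ᵇ y))
≢⇒≡ᵇ-false {x = x} {y} x≢y with x ≡ᵇ y in eq
... | true  = x≢y (≡ᵇ⇒≡ (subst T (sym eq) tt))
... | false = tt

≡ᵇ-transfer : {x y : Fin m} {x′ y′ : Fin n} → (x ≡ᵇ y) ≡ (x′ ≡ᵇ y′) →
              (x ≡ y → x′ ≡ y′) × (x′ ≡ y′ → x ≡ y)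
≡ᵇ-transfer eq = (λ x≡y → ≡ᵇ⇒≡ (subst T eq (≡⇒≡ᵇ x≡y))) ,
                 (λ x′≡y′ → ≡ᵇ⇒≡ (subst T (sym eq) (≡⇒≡ᵇ x′≡y′)))

_≐_ : Vec Bool n → Vec Bool n → Bool
[]           ≐ []           = true
(true  ∷ as) ≐ (true  ∷ bs) = as ≐ bs
(false ∷ as) ≐ (false ∷ bs) = as ≐ bs
(_     ∷ _)  ≐ (_     ∷ _)  = false

≐⇒≡ : {as bs : Vec Bool n} → T (as ≐ bs) → as ≡ bs
≐⇒≡ {as = []}         {[]}         _ = refl
≐⇒≡ {as = true  ∷ as} {true  ∷ bs} t = cong (true ∷_) (≐⇒≡ t)
≐⇒≡ {as = false ∷ as} {false ∷ bs} t = cong (false ∷_) (≐⇒≡ t)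

infixr 1 _⇒ᵇ_

_⇒ᵇ_ : Bool → Bool → Bool
true  ⇒ᵇ b = b
false ⇒ᵇ _ = true

⇒ᵇ-elim : ∀ {a b} → T (a ⇒ᵇ b) → T a → T b
⇒ᵇ-elim {true} b _ = b

⇒ᵇ-intro : ∀ {a b} → (T a → T b) → T (a ⇒ᵇ b)
⇒ᵇ-intro {true}  f = f tt
⇒ᵇ-intro {false} _ = tt

-- Opaque, so that the predicate of a check can be read off its type.
opaque
  allFinᵇ : (Fin n → Bool) → Bool
  allFinᵇ p = all p (allFin _)

  allFinᵇ-sound : ∀ {p : Fin n → Bool} → T (allFinᵇ p) → ∀ k → T (p k)
  allFinᵇ-sound {p = p} holds k = All.lookup (All.all⁺ p (allFin _) holds) (∈-allFin k)

  allFromᵇ : Fin n → (Fin n → Bool) → Bool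
  allFromᵇ k p = allFinᵇ λ k′ → toℕ k ℕ.≤ᵇ toℕ k′ ⇒ᵇ p k′

  allFromᵇ-sound : ∀ {k k′ : Fin n} {p} → T (allFromᵇ k p) → k ≤ k′ → T (p k′)
  allFromᵇ-sound {k′ = k′} holds k≤k′ = ⇒ᵇ-elim (allFinᵇ-sound holds k′) (ℕ.≤⇒≤ᵇ k≤k′)

_≡ᵇᵥ_ : Vertex → Vertex → Bool
(i , a) ≡ᵇᵥ (j , b) = i ≡ᵇ j ∧ a ≡ᵇ b

conflictᵇ : Fin 25 → Fin 25 → Bool
conflictᵇ k l = not (k ≡ᵇ l) ∧ (x ≡ᵇᵥ x′ ∨ x ≡ᵇᵥ y′ ∨ y ≡ᵇᵥ x′ ∨ y ≡ᵇᵥ y′)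
  where
  x = endpoint₁ k ; y = endpoint₂ k ; x′ = endpoint₁ l ; y′ = endpoint₂ l

opaque
  conflictᵇ-correct : ∀ k l → (T (conflictᵇ k l) → Conflict k l) × (Conflict k l → T (conflictᵇ k l))
  conflictᵇ-correct = from-yes (all? λ k → all? λ l →
    (T? (conflictᵇ k l) →-dec conflict? k l) ×-dec (conflict? k l →-dec T? (conflictᵇ k l)))

pairs : Vec A 4 → Vec (A × A) 6
pairs (a ∷ b ∷ c ∷ d ∷ []) = (a , b) ∷ (a , c) ∷ (a , d) ∷ (b , c) ∷ (b , d) ∷ (c , d) ∷ []

profile : Vec (Fin m) 4 → Vec Bool 6
profile xs = Vec.map (uncurry _≡ᵇ_) (pairs xs)

profile⇒samePattern : (xs : Vec (Fin m) 4) (ys : Vec (Fin n) 4) → profile xs ≡ profile ys →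
                      SamePattern xs ys
profile⇒samePattern {m} {n} (a ∷ b ∷ c ∷ d ∷ []) (a′ ∷ b′ ∷ c′ ∷ d′ ∷ []) same = λ where
    0F 0F → diagonal       ; 0F 1F → forward 0F     ; 0F 2F → forward 1F     ; 0F 3F → forward 2F
    1F 0F → backward 0F    ; 1F 1F → diagonal       ; 1F 2F → forward 3F     ; 1F 3F → forward 4F
    2F 0F → backward 1F    ; 2F 1F → backward 3F    ; 2F 2F → diagonal       ; 2F 3F → forward 5F
    3F 0F → backward 2F    ; 3F 1F → backward 4F    ; 3F 2F → backward 5F    ; 3F 3F → diagonal
  where
  diagonal : ∀ {x : Fin m} {x′ : Fin n} → (x ≡ x → x′ ≡ x′) × (x′ ≡ x′ → x ≡ x)
  diagonal = (λ _ → refl) , (λ _ → refl)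

  x y : Fin 6 → Fin m
  x q = proj₁ (lookup (pairs (a ∷ b ∷ c ∷ d ∷ [])) q)
  y q = proj₂ (lookup (pairs (a ∷ b ∷ c ∷ d ∷ [])) q)

  x′ y′ : Fin 6 → Fin n
  x′ q = proj₁ (lookup (pairs (a′ ∷ b′ ∷ c′ ∷ d′ ∷ [])) q)
  y′ q = proj₂ (lookup (pairs (a′ ∷ b′ ∷ c′ ∷ d′ ∷ [])) q)

  forward : ∀ q → (x q ≡ y q → x′ q ≡ y′ q) × (x′ q ≡ y′ q → x q ≡ y q)
  forward q = ≡ᵇ-transfer (begin
    x q ≡ᵇ y q                                   ≡⟨ lookup-map q _ (pairs (a ∷ b ∷ c ∷ d ∷ [])) ⟨
    lookup (profile (a ∷ b ∷ c ∷ d ∷ [])) q      ≡⟨ cong (λ bs → lookup bs q) same ⟩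
    lookup (profile (a′ ∷ b′ ∷ c′ ∷ d′ ∷ [])) q  ≡⟨ lookup-map q _ (pairs (a′ ∷ b′ ∷ c′ ∷ d′ ∷ [])) ⟩
    x′ q ≡ᵇ y′ q                                 ∎)

  backward : ∀ q → (y q ≡ x q → y′ q ≡ x′ q) × (y′ q ≡ x′ q → y q ≡ x q)
  backward q = let (to , from) = forward q in sym ∘ to ∘ sym , sym ∘ from ∘ sym

-- One representative of each of the fifteen partitions of four positions.
canonicalPatterns : List (Vec (Fin 4) 4)
canonicalPatterns =
  (0F ∷ 0F ∷ 0F ∷ 0F ∷ [])
  ∷ (0F ∷ 0F ∷ 0F ∷ 1F ∷ [])
  ∷ (0F ∷ 0F ∷ 1F ∷ 0F ∷ [])
  ∷ (0F ∷ 0F ∷ 1F ∷ 1F ∷ [])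
  ∷ (0F ∷ 0F ∷ 1F ∷ 2F ∷ [])
  ∷ (0F ∷ 1F ∷ 0F ∷ 0F ∷ [])
  ∷ (0F ∷ 1F ∷ 0F ∷ 1F ∷ [])
  ∷ (0F ∷ 1F ∷ 0F ∷ 2F ∷ [])
  ∷ (0F ∷ 1F ∷ 1F ∷ 0F ∷ [])
  ∷ (0F ∷ 1F ∷ 1F ∷ 1F ∷ [])
  ∷ (0F ∷ 1F ∷ 1F ∷ 2F ∷ [])
  ∷ (0F ∷ 1F ∷ 2F ∷ 0F ∷ [])
  ∷ (0F ∷ 1F ∷ 2F ∷ 1F ∷ [])
  ∷ (0F ∷ 1F ∷ 2F ∷ 2F ∷ [])
  ∷ (0F ∷ 1F ∷ 2F ∷ 3F ∷ [])
  ∷ []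

patterns-completeᵇ : Bool
patterns-completeᵇ = allFinᵇ λ (a : Color) → allFinᵇ λ b → allFinᵇ λ c → allFinᵇ λ d →
  any (λ p → profile (a ∷ b ∷ c ∷ d ∷ []) ≐ profile p) canonicalPatterns

opaque
  unfolding allFinᵇ

  patterns-completeᵇ-holds : patterns-completeᵇ ≡ true
  patterns-completeᵇ-holds = refl

patterns-complete-at : (a b c d : Color) →
                       T (any (λ p → profile (a ∷ b ∷ c ∷ d ∷ []) ≐ profile p) canonicalPatterns)
patterns-complete-at a b c d = allFinᵇ-sound (allFinᵇ-sound (allFinᵇ-sound (allFinᵇ-sound
  (Equivalence.from T-≡ patterns-completeᵇ-holds) a) b) c) d

patterns-complete : (cs : Vec Color 4) → ∃ λ p → p ∈ canonicalPatterns × profile cs ≡ profile p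
patterns-complete (a ∷ b ∷ c ∷ d ∷ [])
  with find (any⁻ (λ p → profile (a ∷ b ∷ c ∷ d ∷ []) ≐ profile p) canonicalPatterns
                  (patterns-complete-at a b c d))
... | p , p∈ , same = p , p∈ , ≐⇒≡ same

-- The catalog

opaque
  catalog : List (Vec Color 25)
  catalog =
    (3F ∷ 4F ∷ 1F ∷ 0F ∷ 5F ∷ 0F ∷ 1F ∷ 4F ∷ 5F ∷ 3F ∷ 5F ∷ 2F ∷ 0F ∷ 5F ∷ 2F ∷ 4F ∷ 4F ∷ 3F ∷ 2F ∷ 0F ∷ 2F ∷ 5F ∷ 1F ∷ 1F ∷ 3F ∷ [])
    ∷ (4F ∷ 3F ∷ 0F ∷ 1F ∷ 5F ∷ 3F ∷ 1F ∷ 2F ∷ 0F ∷ 5F ∷ 4F ∷ 0F ∷ 2F ∷ 2F ∷ 4F ∷ 1F ∷ 3F ∷ 2F ∷ 1F ∷ 0F ∷ 4F ∷ 3F ∷ 4F ∷ 5F ∷ 3F ∷ [])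
    ∷ (5F ∷ 1F ∷ 3F ∷ 4F ∷ 2F ∷ 4F ∷ 3F ∷ 1F ∷ 0F ∷ 0F ∷ 4F ∷ 3F ∷ 5F ∷ 1F ∷ 3F ∷ 2F ∷ 0F ∷ 2F ∷ 1F ∷ 2F ∷ 5F ∷ 5F ∷ 0F ∷ 4F ∷ 3F ∷ [])
    ∷ (5F ∷ 2F ∷ 0F ∷ 4F ∷ 3F ∷ 3F ∷ 1F ∷ 0F ∷ 4F ∷ 1F ∷ 5F ∷ 3F ∷ 4F ∷ 2F ∷ 4F ∷ 0F ∷ 4F ∷ 2F ∷ 1F ∷ 5F ∷ 3F ∷ 1F ∷ 0F ∷ 2F ∷ 5F ∷ [])
    ∷ (1F ∷ 2F ∷ 4F ∷ 0F ∷ 5F ∷ 3F ∷ 5F ∷ 0F ∷ 2F ∷ 0F ∷ 5F ∷ 1F ∷ 3F ∷ 4F ∷ 5F ∷ 1F ∷ 1F ∷ 3F ∷ 0F ∷ 2F ∷ 0F ∷ 4F ∷ 2F ∷ 3F ∷ 4F ∷ [])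
    ∷ (2F ∷ 0F ∷ 1F ∷ 4F ∷ 3F ∷ 5F ∷ 1F ∷ 4F ∷ 0F ∷ 3F ∷ 5F ∷ 2F ∷ 1F ∷ 4F ∷ 0F ∷ 1F ∷ 2F ∷ 3F ∷ 0F ∷ 3F ∷ 5F ∷ 1F ∷ 5F ∷ 2F ∷ 4F ∷ [])
    ∷ (3F ∷ 2F ∷ 5F ∷ 4F ∷ 0F ∷ 1F ∷ 2F ∷ 0F ∷ 4F ∷ 5F ∷ 3F ∷ 1F ∷ 4F ∷ 3F ∷ 4F ∷ 0F ∷ 0F ∷ 2F ∷ 1F ∷ 1F ∷ 5F ∷ 5F ∷ 3F ∷ 3F ∷ 2F ∷ [])
    ∷ (5F ∷ 4F ∷ 3F ∷ 1F ∷ 0F ∷ 3F ∷ 4F ∷ 0F ∷ 2F ∷ 0F ∷ 5F ∷ 2F ∷ 1F ∷ 2F ∷ 4F ∷ 5F ∷ 1F ∷ 0F ∷ 2F ∷ 3F ∷ 0F ∷ 5F ∷ 4F ∷ 1F ∷ 3F ∷ [])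
    ∷ (4F ∷ 5F ∷ 1F ∷ 0F ∷ 3F ∷ 5F ∷ 2F ∷ 1F ∷ 3F ∷ 2F ∷ 0F ∷ 1F ∷ 4F ∷ 0F ∷ 3F ∷ 4F ∷ 4F ∷ 3F ∷ 2F ∷ 5F ∷ 1F ∷ 4F ∷ 5F ∷ 2F ∷ 0F ∷ [])
    ∷ (5F ∷ 3F ∷ 4F ∷ 2F ∷ 0F ∷ 0F ∷ 1F ∷ 3F ∷ 2F ∷ 2F ∷ 1F ∷ 0F ∷ 4F ∷ 4F ∷ 5F ∷ 1F ∷ 0F ∷ 5F ∷ 2F ∷ 2F ∷ 3F ∷ 1F ∷ 3F ∷ 4F ∷ 5F ∷ [])
    ∷ (5F ∷ 3F ∷ 0F ∷ 1F ∷ 4F ∷ 3F ∷ 1F ∷ 2F ∷ 4F ∷ 4F ∷ 2F ∷ 5F ∷ 1F ∷ 2F ∷ 0F ∷ 5F ∷ 4F ∷ 3F ∷ 5F ∷ 3F ∷ 0F ∷ 4F ∷ 0F ∷ 1F ∷ 3F ∷ [])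
    ∷ (3F ∷ 2F ∷ 4F ∷ 5F ∷ 1F ∷ 2F ∷ 5F ∷ 0F ∷ 4F ∷ 3F ∷ 5F ∷ 1F ∷ 4F ∷ 1F ∷ 5F ∷ 0F ∷ 0F ∷ 3F ∷ 2F ∷ 4F ∷ 2F ∷ 2F ∷ 0F ∷ 3F ∷ 5F ∷ [])
    ∷ (1F ∷ 2F ∷ 0F ∷ 5F ∷ 4F ∷ 4F ∷ 3F ∷ 0F ∷ 2F ∷ 1F ∷ 5F ∷ 0F ∷ 3F ∷ 2F ∷ 3F ∷ 5F ∷ 4F ∷ 3F ∷ 2F ∷ 5F ∷ 1F ∷ 2F ∷ 1F ∷ 4F ∷ 0F ∷ [])
    ∷ (4F ∷ 0F ∷ 3F ∷ 1F ∷ 5F ∷ 0F ∷ 3F ∷ 1F ∷ 5F ∷ 1F ∷ 2F ∷ 5F ∷ 4F ∷ 5F ∷ 3F ∷ 4F ∷ 1F ∷ 4F ∷ 0F ∷ 4F ∷ 2F ∷ 2F ∷ 3F ∷ 0F ∷ 1F ∷ [])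
    ∷ (2F ∷ 3F ∷ 5F ∷ 4F ∷ 0F ∷ 1F ∷ 0F ∷ 4F ∷ 3F ∷ 5F ∷ 1F ∷ 0F ∷ 4F ∷ 3F ∷ 2F ∷ 4F ∷ 4F ∷ 3F ∷ 2F ∷ 1F ∷ 2F ∷ 5F ∷ 1F ∷ 0F ∷ 5F ∷ [])
    ∷ (2F ∷ 4F ∷ 0F ∷ 5F ∷ 1F ∷ 0F ∷ 4F ∷ 3F ∷ 1F ∷ 2F ∷ 1F ∷ 3F ∷ 5F ∷ 3F ∷ 5F ∷ 4F ∷ 2F ∷ 4F ∷ 3F ∷ 1F ∷ 5F ∷ 0F ∷ 2F ∷ 2F ∷ 0F ∷ [])
    ∷ (3F ∷ 0F ∷ 5F ∷ 2F ∷ 1F ∷ 1F ∷ 4F ∷ 0F ∷ 2F ∷ 4F ∷ 2F ∷ 3F ∷ 5F ∷ 5F ∷ 3F ∷ 0F ∷ 3F ∷ 1F ∷ 0F ∷ 2F ∷ 1F ∷ 5F ∷ 4F ∷ 4F ∷ 3F ∷ [])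
    ∷ (3F ∷ 2F ∷ 4F ∷ 0F ∷ 1F ∷ 2F ∷ 1F ∷ 5F ∷ 4F ∷ 3F ∷ 1F ∷ 4F ∷ 5F ∷ 0F ∷ 4F ∷ 1F ∷ 2F ∷ 5F ∷ 0F ∷ 3F ∷ 5F ∷ 1F ∷ 3F ∷ 0F ∷ 2F ∷ [])
    ∷ (1F ∷ 0F ∷ 3F ∷ 2F ∷ 4F ∷ 3F ∷ 0F ∷ 2F ∷ 5F ∷ 2F ∷ 5F ∷ 4F ∷ 3F ∷ 1F ∷ 5F ∷ 4F ∷ 2F ∷ 1F ∷ 0F ∷ 4F ∷ 3F ∷ 3F ∷ 5F ∷ 0F ∷ 1F ∷ [])
    ∷ (1F ∷ 4F ∷ 3F ∷ 0F ∷ 2F ∷ 4F ∷ 5F ∷ 2F ∷ 3F ∷ 3F ∷ 2F ∷ 1F ∷ 5F ∷ 2F ∷ 0F ∷ 5F ∷ 4F ∷ 5F ∷ 0F ∷ 1F ∷ 0F ∷ 3F ∷ 4F ∷ 4F ∷ 1F ∷ [])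
    ∷ (4F ∷ 3F ∷ 2F ∷ 0F ∷ 5F ∷ 5F ∷ 2F ∷ 0F ∷ 3F ∷ 0F ∷ 5F ∷ 4F ∷ 1F ∷ 4F ∷ 1F ∷ 2F ∷ 1F ∷ 3F ∷ 4F ∷ 3F ∷ 5F ∷ 5F ∷ 2F ∷ 4F ∷ 0F ∷ [])
    ∷ (4F ∷ 1F ∷ 2F ∷ 3F ∷ 5F ∷ 3F ∷ 0F ∷ 5F ∷ 2F ∷ 0F ∷ 4F ∷ 5F ∷ 2F ∷ 4F ∷ 2F ∷ 1F ∷ 5F ∷ 0F ∷ 3F ∷ 1F ∷ 3F ∷ 4F ∷ 1F ∷ 0F ∷ 4F ∷ [])
    ∷ (4F ∷ 5F ∷ 3F ∷ 0F ∷ 1F ∷ 2F ∷ 3F ∷ 0F ∷ 1F ∷ 3F ∷ 1F ∷ 4F ∷ 0F ∷ 0F ∷ 5F ∷ 4F ∷ 2F ∷ 5F ∷ 4F ∷ 4F ∷ 5F ∷ 1F ∷ 2F ∷ 2F ∷ 3F ∷ [])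
    ∷ (5F ∷ 2F ∷ 0F ∷ 1F ∷ 4F ∷ 2F ∷ 0F ∷ 3F ∷ 1F ∷ 1F ∷ 3F ∷ 0F ∷ 5F ∷ 3F ∷ 4F ∷ 5F ∷ 2F ∷ 4F ∷ 1F ∷ 1F ∷ 4F ∷ 2F ∷ 3F ∷ 0F ∷ 2F ∷ [])
    ∷ (3F ∷ 2F ∷ 4F ∷ 0F ∷ 1F ∷ 1F ∷ 5F ∷ 0F ∷ 4F ∷ 4F ∷ 1F ∷ 5F ∷ 0F ∷ 3F ∷ 5F ∷ 2F ∷ 2F ∷ 3F ∷ 5F ∷ 4F ∷ 0F ∷ 2F ∷ 4F ∷ 1F ∷ 3F ∷ [])
    ∷ (4F ∷ 1F ∷ 0F ∷ 2F ∷ 3F ∷ 5F ∷ 1F ∷ 2F ∷ 3F ∷ 4F ∷ 2F ∷ 0F ∷ 5F ∷ 2F ∷ 3F ∷ 0F ∷ 3F ∷ 5F ∷ 4F ∷ 0F ∷ 5F ∷ 4F ∷ 1F ∷ 1F ∷ 2F ∷ [])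
    ∷ (4F ∷ 1F ∷ 5F ∷ 2F ∷ 0F ∷ 3F ∷ 0F ∷ 1F ∷ 2F ∷ 0F ∷ 4F ∷ 3F ∷ 5F ∷ 1F ∷ 5F ∷ 4F ∷ 3F ∷ 1F ∷ 2F ∷ 4F ∷ 5F ∷ 0F ∷ 4F ∷ 3F ∷ 1F ∷ [])
    ∷ (1F ∷ 2F ∷ 0F ∷ 4F ∷ 5F ∷ 4F ∷ 3F ∷ 0F ∷ 5F ∷ 5F ∷ 3F ∷ 1F ∷ 0F ∷ 2F ∷ 1F ∷ 3F ∷ 4F ∷ 5F ∷ 1F ∷ 5F ∷ 1F ∷ 3F ∷ 2F ∷ 2F ∷ 4F ∷ [])
    ∷ (3F ∷ 4F ∷ 1F ∷ 5F ∷ 0F ∷ 2F ∷ 5F ∷ 1F ∷ 4F ∷ 1F ∷ 5F ∷ 0F ∷ 3F ∷ 3F ∷ 4F ∷ 0F ∷ 4F ∷ 3F ∷ 2F ∷ 0F ∷ 1F ∷ 2F ∷ 1F ∷ 3F ∷ 5F ∷ [])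
    ∷ (3F ∷ 5F ∷ 2F ∷ 1F ∷ 4F ∷ 5F ∷ 0F ∷ 1F ∷ 2F ∷ 4F ∷ 1F ∷ 3F ∷ 0F ∷ 2F ∷ 3F ∷ 1F ∷ 3F ∷ 0F ∷ 5F ∷ 5F ∷ 4F ∷ 4F ∷ 2F ∷ 0F ∷ 3F ∷ [])
    ∷ (0F ∷ 1F ∷ 5F ∷ 4F ∷ 3F ∷ 1F ∷ 3F ∷ 2F ∷ 5F ∷ 4F ∷ 3F ∷ 2F ∷ 0F ∷ 5F ∷ 0F ∷ 2F ∷ 1F ∷ 0F ∷ 2F ∷ 4F ∷ 0F ∷ 5F ∷ 1F ∷ 3F ∷ 4F ∷ [])
    ∷ (2F ∷ 5F ∷ 4F ∷ 1F ∷ 0F ∷ 1F ∷ 3F ∷ 0F ∷ 5F ∷ 3F ∷ 2F ∷ 4F ∷ 1F ∷ 4F ∷ 2F ∷ 0F ∷ 1F ∷ 0F ∷ 5F ∷ 5F ∷ 2F ∷ 3F ∷ 2F ∷ 4F ∷ 3F ∷ [])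
    ∷ (0F ∷ 3F ∷ 2F ∷ 5F ∷ 4F ∷ 2F ∷ 3F ∷ 5F ∷ 1F ∷ 0F ∷ 4F ∷ 2F ∷ 1F ∷ 4F ∷ 1F ∷ 3F ∷ 0F ∷ 1F ∷ 5F ∷ 2F ∷ 5F ∷ 0F ∷ 3F ∷ 4F ∷ 2F ∷ [])
    ∷ (0F ∷ 4F ∷ 3F ∷ 2F ∷ 1F ∷ 5F ∷ 3F ∷ 1F ∷ 2F ∷ 3F ∷ 2F ∷ 1F ∷ 5F ∷ 2F ∷ 4F ∷ 0F ∷ 4F ∷ 5F ∷ 0F ∷ 5F ∷ 1F ∷ 0F ∷ 3F ∷ 3F ∷ 4F ∷ [])
    ∷ (5F ∷ 2F ∷ 3F ∷ 0F ∷ 4F ∷ 1F ∷ 4F ∷ 2F ∷ 3F ∷ 4F ∷ 0F ∷ 5F ∷ 1F ∷ 5F ∷ 3F ∷ 0F ∷ 1F ∷ 4F ∷ 2F ∷ 0F ∷ 2F ∷ 1F ∷ 3F ∷ 4F ∷ 5F ∷ [])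
    ∷ (4F ∷ 3F ∷ 5F ∷ 0F ∷ 2F ∷ 5F ∷ 3F ∷ 1F ∷ 2F ∷ 1F ∷ 2F ∷ 5F ∷ 0F ∷ 2F ∷ 4F ∷ 0F ∷ 4F ∷ 1F ∷ 3F ∷ 0F ∷ 5F ∷ 2F ∷ 4F ∷ 3F ∷ 1F ∷ [])
    ∷ (3F ∷ 4F ∷ 0F ∷ 2F ∷ 1F ∷ 1F ∷ 2F ∷ 5F ∷ 0F ∷ 3F ∷ 5F ∷ 1F ∷ 0F ∷ 0F ∷ 2F ∷ 4F ∷ 3F ∷ 4F ∷ 2F ∷ 4F ∷ 5F ∷ 3F ∷ 5F ∷ 1F ∷ 3F ∷ [])
    ∷ (4F ∷ 3F ∷ 0F ∷ 2F ∷ 5F ∷ 2F ∷ 0F ∷ 3F ∷ 1F ∷ 0F ∷ 4F ∷ 5F ∷ 1F ∷ 4F ∷ 5F ∷ 3F ∷ 1F ∷ 3F ∷ 2F ∷ 2F ∷ 5F ∷ 1F ∷ 4F ∷ 4F ∷ 0F ∷ [])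
    ∷ (2F ∷ 1F ∷ 3F ∷ 5F ∷ 4F ∷ 3F ∷ 5F ∷ 0F ∷ 1F ∷ 4F ∷ 5F ∷ 2F ∷ 0F ∷ 1F ∷ 5F ∷ 0F ∷ 4F ∷ 0F ∷ 1F ∷ 3F ∷ 2F ∷ 1F ∷ 3F ∷ 4F ∷ 5F ∷ [])
    ∷ (5F ∷ 0F ∷ 1F ∷ 2F ∷ 4F ∷ 0F ∷ 4F ∷ 1F ∷ 3F ∷ 5F ∷ 3F ∷ 4F ∷ 1F ∷ 1F ∷ 2F ∷ 4F ∷ 2F ∷ 0F ∷ 5F ∷ 3F ∷ 5F ∷ 5F ∷ 3F ∷ 0F ∷ 2F ∷ [])
    ∷ (0F ∷ 4F ∷ 2F ∷ 3F ∷ 1F ∷ 2F ∷ 5F ∷ 4F ∷ 1F ∷ 1F ∷ 3F ∷ 5F ∷ 0F ∷ 4F ∷ 3F ∷ 0F ∷ 1F ∷ 0F ∷ 5F ∷ 0F ∷ 3F ∷ 1F ∷ 4F ∷ 5F ∷ 2F ∷ [])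
    ∷ (4F ∷ 5F ∷ 2F ∷ 3F ∷ 0F ∷ 1F ∷ 5F ∷ 2F ∷ 0F ∷ 2F ∷ 1F ∷ 0F ∷ 3F ∷ 3F ∷ 0F ∷ 5F ∷ 0F ∷ 4F ∷ 5F ∷ 4F ∷ 1F ∷ 1F ∷ 2F ∷ 3F ∷ 4F ∷ [])
    ∷ (0F ∷ 5F ∷ 2F ∷ 1F ∷ 3F ∷ 3F ∷ 1F ∷ 4F ∷ 2F ∷ 1F ∷ 0F ∷ 4F ∷ 2F ∷ 0F ∷ 2F ∷ 5F ∷ 5F ∷ 3F ∷ 1F ∷ 3F ∷ 4F ∷ 0F ∷ 5F ∷ 1F ∷ 0F ∷ [])
    ∷ (3F ∷ 0F ∷ 1F ∷ 4F ∷ 5F ∷ 0F ∷ 1F ∷ 5F ∷ 2F ∷ 1F ∷ 4F ∷ 2F ∷ 3F ∷ 5F ∷ 2F ∷ 4F ∷ 3F ∷ 5F ∷ 2F ∷ 4F ∷ 0F ∷ 1F ∷ 0F ∷ 3F ∷ 1F ∷ [])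
    ∷ (0F ∷ 3F ∷ 5F ∷ 1F ∷ 4F ∷ 2F ∷ 1F ∷ 4F ∷ 3F ∷ 4F ∷ 2F ∷ 0F ∷ 1F ∷ 5F ∷ 3F ∷ 1F ∷ 3F ∷ 4F ∷ 0F ∷ 0F ∷ 4F ∷ 2F ∷ 3F ∷ 5F ∷ 2F ∷ [])
    ∷ (3F ∷ 1F ∷ 0F ∷ 5F ∷ 2F ∷ 0F ∷ 1F ∷ 4F ∷ 2F ∷ 2F ∷ 5F ∷ 4F ∷ 0F ∷ 4F ∷ 3F ∷ 1F ∷ 3F ∷ 2F ∷ 1F ∷ 2F ∷ 0F ∷ 1F ∷ 3F ∷ 5F ∷ 4F ∷ [])
    ∷ (2F ∷ 0F ∷ 3F ∷ 1F ∷ 5F ∷ 3F ∷ 5F ∷ 4F ∷ 1F ∷ 1F ∷ 2F ∷ 3F ∷ 4F ∷ 2F ∷ 5F ∷ 4F ∷ 4F ∷ 5F ∷ 1F ∷ 1F ∷ 0F ∷ 0F ∷ 2F ∷ 2F ∷ 3F ∷ [])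
    ∷ (4F ∷ 3F ∷ 0F ∷ 2F ∷ 5F ∷ 1F ∷ 5F ∷ 0F ∷ 2F ∷ 4F ∷ 5F ∷ 0F ∷ 1F ∷ 2F ∷ 3F ∷ 0F ∷ 4F ∷ 1F ∷ 2F ∷ 1F ∷ 3F ∷ 4F ∷ 3F ∷ 5F ∷ 4F ∷ [])
    ∷ (0F ∷ 5F ∷ 3F ∷ 4F ∷ 2F ∷ 3F ∷ 1F ∷ 4F ∷ 2F ∷ 4F ∷ 1F ∷ 3F ∷ 0F ∷ 2F ∷ 5F ∷ 1F ∷ 5F ∷ 0F ∷ 4F ∷ 3F ∷ 4F ∷ 2F ∷ 1F ∷ 0F ∷ 3F ∷ [])
    ∷ (3F ∷ 2F ∷ 5F ∷ 4F ∷ 0F ∷ 2F ∷ 5F ∷ 4F ∷ 1F ∷ 4F ∷ 1F ∷ 0F ∷ 5F ∷ 0F ∷ 1F ∷ 3F ∷ 3F ∷ 2F ∷ 4F ∷ 2F ∷ 4F ∷ 5F ∷ 3F ∷ 0F ∷ 2F ∷ [])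
    ∷ (4F ∷ 1F ∷ 0F ∷ 5F ∷ 2F ∷ 2F ∷ 1F ∷ 0F ∷ 5F ∷ 0F ∷ 3F ∷ 2F ∷ 4F ∷ 5F ∷ 3F ∷ 4F ∷ 4F ∷ 1F ∷ 5F ∷ 2F ∷ 3F ∷ 4F ∷ 3F ∷ 1F ∷ 0F ∷ [])
    ∷ (5F ∷ 1F ∷ 4F ∷ 0F ∷ 2F ∷ 1F ∷ 0F ∷ 4F ∷ 3F ∷ 0F ∷ 2F ∷ 5F ∷ 3F ∷ 4F ∷ 3F ∷ 2F ∷ 5F ∷ 3F ∷ 1F ∷ 2F ∷ 1F ∷ 1F ∷ 4F ∷ 5F ∷ 0F ∷ [])
    ∷ (2F ∷ 4F ∷ 1F ∷ 5F ∷ 3F ∷ 5F ∷ 0F ∷ 1F ∷ 3F ∷ 1F ∷ 3F ∷ 0F ∷ 5F ∷ 3F ∷ 4F ∷ 2F ∷ 5F ∷ 4F ∷ 2F ∷ 2F ∷ 1F ∷ 3F ∷ 1F ∷ 5F ∷ 0F ∷ [])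
    ∷ (4F ∷ 1F ∷ 0F ∷ 2F ∷ 5F ∷ 0F ∷ 1F ∷ 2F ∷ 5F ∷ 5F ∷ 2F ∷ 3F ∷ 4F ∷ 2F ∷ 3F ∷ 1F ∷ 3F ∷ 5F ∷ 1F ∷ 5F ∷ 4F ∷ 4F ∷ 0F ∷ 0F ∷ 2F ∷ [])
    ∷ (1F ∷ 5F ∷ 2F ∷ 4F ∷ 0F ∷ 3F ∷ 2F ∷ 5F ∷ 0F ∷ 4F ∷ 1F ∷ 0F ∷ 2F ∷ 1F ∷ 0F ∷ 2F ∷ 3F ∷ 5F ∷ 4F ∷ 4F ∷ 5F ∷ 1F ∷ 3F ∷ 3F ∷ 1F ∷ [])
    ∷ (4F ∷ 3F ∷ 1F ∷ 0F ∷ 2F ∷ 1F ∷ 0F ∷ 2F ∷ 3F ∷ 2F ∷ 4F ∷ 5F ∷ 1F ∷ 4F ∷ 5F ∷ 0F ∷ 5F ∷ 2F ∷ 0F ∷ 1F ∷ 2F ∷ 3F ∷ 4F ∷ 4F ∷ 5F ∷ [])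
    ∷ (4F ∷ 0F ∷ 2F ∷ 5F ∷ 3F ∷ 0F ∷ 3F ∷ 1F ∷ 5F ∷ 5F ∷ 1F ∷ 3F ∷ 2F ∷ 4F ∷ 3F ∷ 1F ∷ 5F ∷ 0F ∷ 4F ∷ 0F ∷ 2F ∷ 2F ∷ 1F ∷ 4F ∷ 0F ∷ [])
    ∷ (2F ∷ 1F ∷ 3F ∷ 4F ∷ 0F ∷ 4F ∷ 1F ∷ 0F ∷ 5F ∷ 2F ∷ 4F ∷ 0F ∷ 3F ∷ 0F ∷ 5F ∷ 3F ∷ 5F ∷ 1F ∷ 2F ∷ 3F ∷ 2F ∷ 2F ∷ 5F ∷ 1F ∷ 4F ∷ [])
    ∷ (3F ∷ 1F ∷ 5F ∷ 0F ∷ 4F ∷ 2F ∷ 0F ∷ 1F ∷ 5F ∷ 5F ∷ 0F ∷ 2F ∷ 3F ∷ 1F ∷ 4F ∷ 3F ∷ 3F ∷ 4F ∷ 2F ∷ 5F ∷ 4F ∷ 3F ∷ 5F ∷ 0F ∷ 1F ∷ [])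
    ∷ (0F ∷ 3F ∷ 1F ∷ 4F ∷ 5F ∷ 5F ∷ 4F ∷ 3F ∷ 1F ∷ 0F ∷ 5F ∷ 2F ∷ 1F ∷ 1F ∷ 4F ∷ 2F ∷ 3F ∷ 0F ∷ 2F ∷ 2F ∷ 0F ∷ 1F ∷ 3F ∷ 5F ∷ 4F ∷ [])
    ∷ (4F ∷ 1F ∷ 2F ∷ 0F ∷ 5F ∷ 1F ∷ 2F ∷ 3F ∷ 0F ∷ 4F ∷ 3F ∷ 2F ∷ 0F ∷ 0F ∷ 2F ∷ 5F ∷ 5F ∷ 4F ∷ 1F ∷ 1F ∷ 3F ∷ 5F ∷ 3F ∷ 4F ∷ 2F ∷ [])
    ∷ (3F ∷ 5F ∷ 0F ∷ 2F ∷ 1F ∷ 2F ∷ 0F ∷ 4F ∷ 5F ∷ 3F ∷ 1F ∷ 4F ∷ 2F ∷ 1F ∷ 0F ∷ 4F ∷ 4F ∷ 3F ∷ 5F ∷ 3F ∷ 2F ∷ 5F ∷ 0F ∷ 1F ∷ 3F ∷ [])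
    ∷ (2F ∷ 5F ∷ 4F ∷ 3F ∷ 0F ∷ 5F ∷ 4F ∷ 0F ∷ 1F ∷ 0F ∷ 2F ∷ 4F ∷ 1F ∷ 3F ∷ 2F ∷ 4F ∷ 5F ∷ 1F ∷ 3F ∷ 1F ∷ 2F ∷ 5F ∷ 2F ∷ 3F ∷ 5F ∷ [])
    ∷ (0F ∷ 5F ∷ 2F ∷ 4F ∷ 3F ∷ 3F ∷ 5F ∷ 1F ∷ 2F ∷ 2F ∷ 4F ∷ 3F ∷ 1F ∷ 0F ∷ 5F ∷ 4F ∷ 3F ∷ 5F ∷ 0F ∷ 4F ∷ 1F ∷ 0F ∷ 2F ∷ 3F ∷ 5F ∷ [])
    ∷ (3F ∷ 4F ∷ 1F ∷ 2F ∷ 0F ∷ 2F ∷ 5F ∷ 0F ∷ 4F ∷ 5F ∷ 0F ∷ 1F ∷ 3F ∷ 1F ∷ 3F ∷ 0F ∷ 2F ∷ 3F ∷ 5F ∷ 4F ∷ 3F ∷ 5F ∷ 4F ∷ 2F ∷ 1F ∷ [])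
    ∷ (2F ∷ 5F ∷ 3F ∷ 0F ∷ 1F ∷ 0F ∷ 3F ∷ 4F ∷ 1F ∷ 2F ∷ 1F ∷ 3F ∷ 4F ∷ 4F ∷ 1F ∷ 5F ∷ 2F ∷ 4F ∷ 0F ∷ 5F ∷ 0F ∷ 2F ∷ 5F ∷ 3F ∷ 2F ∷ [])
    ∷ (1F ∷ 2F ∷ 0F ∷ 4F ∷ 3F ∷ 3F ∷ 5F ∷ 4F ∷ 0F ∷ 5F ∷ 3F ∷ 0F ∷ 1F ∷ 2F ∷ 0F ∷ 1F ∷ 1F ∷ 5F ∷ 4F ∷ 3F ∷ 4F ∷ 1F ∷ 2F ∷ 2F ∷ 5F ∷ [])
    ∷ (2F ∷ 3F ∷ 5F ∷ 4F ∷ 0F ∷ 3F ∷ 4F ∷ 0F ∷ 1F ∷ 2F ∷ 4F ∷ 1F ∷ 5F ∷ 1F ∷ 4F ∷ 0F ∷ 0F ∷ 3F ∷ 1F ∷ 2F ∷ 5F ∷ 5F ∷ 2F ∷ 3F ∷ 4F ∷ [])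
    ∷ (4F ∷ 0F ∷ 1F ∷ 5F ∷ 3F ∷ 2F ∷ 1F ∷ 0F ∷ 3F ∷ 5F ∷ 2F ∷ 3F ∷ 4F ∷ 3F ∷ 4F ∷ 1F ∷ 0F ∷ 4F ∷ 5F ∷ 5F ∷ 4F ∷ 1F ∷ 2F ∷ 2F ∷ 0F ∷ [])
    ∷ (0F ∷ 1F ∷ 4F ∷ 2F ∷ 3F ∷ 3F ∷ 4F ∷ 2F ∷ 5F ∷ 5F ∷ 2F ∷ 0F ∷ 4F ∷ 2F ∷ 1F ∷ 4F ∷ 5F ∷ 3F ∷ 1F ∷ 0F ∷ 1F ∷ 4F ∷ 5F ∷ 3F ∷ 0F ∷ [])
    ∷ (1F ∷ 3F ∷ 2F ∷ 5F ∷ 0F ∷ 4F ∷ 2F ∷ 3F ∷ 0F ∷ 0F ∷ 4F ∷ 1F ∷ 5F ∷ 3F ∷ 5F ∷ 1F ∷ 5F ∷ 3F ∷ 1F ∷ 0F ∷ 4F ∷ 4F ∷ 2F ∷ 2F ∷ 3F ∷ [])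
    ∷ (3F ∷ 1F ∷ 5F ∷ 2F ∷ 4F ∷ 0F ∷ 5F ∷ 1F ∷ 2F ∷ 3F ∷ 2F ∷ 0F ∷ 5F ∷ 2F ∷ 5F ∷ 1F ∷ 1F ∷ 3F ∷ 0F ∷ 3F ∷ 4F ∷ 4F ∷ 1F ∷ 0F ∷ 3F ∷ [])
    ∷ (3F ∷ 5F ∷ 4F ∷ 1F ∷ 2F ∷ 1F ∷ 4F ∷ 0F ∷ 5F ∷ 4F ∷ 3F ∷ 0F ∷ 1F ∷ 0F ∷ 3F ∷ 2F ∷ 5F ∷ 2F ∷ 0F ∷ 2F ∷ 1F ∷ 5F ∷ 4F ∷ 4F ∷ 3F ∷ [])
    ∷ (0F ∷ 3F ∷ 2F ∷ 1F ∷ 4F ∷ 4F ∷ 3F ∷ 1F ∷ 2F ∷ 5F ∷ 0F ∷ 4F ∷ 1F ∷ 2F ∷ 3F ∷ 1F ∷ 1F ∷ 5F ∷ 3F ∷ 5F ∷ 0F ∷ 0F ∷ 2F ∷ 4F ∷ 5F ∷ [])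
    ∷ (2F ∷ 4F ∷ 5F ∷ 3F ∷ 0F ∷ 4F ∷ 0F ∷ 5F ∷ 3F ∷ 1F ∷ 3F ∷ 2F ∷ 5F ∷ 5F ∷ 2F ∷ 0F ∷ 1F ∷ 0F ∷ 2F ∷ 3F ∷ 2F ∷ 4F ∷ 1F ∷ 1F ∷ 4F ∷ [])
    ∷ (1F ∷ 5F ∷ 0F ∷ 2F ∷ 3F ∷ 5F ∷ 4F ∷ 3F ∷ 2F ∷ 3F ∷ 1F ∷ 0F ∷ 4F ∷ 0F ∷ 2F ∷ 4F ∷ 5F ∷ 3F ∷ 2F ∷ 1F ∷ 3F ∷ 4F ∷ 5F ∷ 0F ∷ 1F ∷ [])
    ∷ (5F ∷ 1F ∷ 2F ∷ 3F ∷ 4F ∷ 4F ∷ 0F ∷ 3F ∷ 2F ∷ 3F ∷ 0F ∷ 5F ∷ 2F ∷ 2F ∷ 0F ∷ 5F ∷ 1F ∷ 4F ∷ 5F ∷ 5F ∷ 4F ∷ 2F ∷ 0F ∷ 1F ∷ 3F ∷ [])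
    ∷ (4F ∷ 1F ∷ 0F ∷ 5F ∷ 3F ∷ 5F ∷ 2F ∷ 0F ∷ 1F ∷ 0F ∷ 2F ∷ 3F ∷ 4F ∷ 1F ∷ 4F ∷ 3F ∷ 4F ∷ 1F ∷ 5F ∷ 3F ∷ 0F ∷ 2F ∷ 0F ∷ 5F ∷ 2F ∷ [])
    ∷ (3F ∷ 0F ∷ 2F ∷ 4F ∷ 5F ∷ 4F ∷ 2F ∷ 1F ∷ 0F ∷ 3F ∷ 5F ∷ 1F ∷ 4F ∷ 5F ∷ 0F ∷ 2F ∷ 4F ∷ 0F ∷ 1F ∷ 3F ∷ 1F ∷ 5F ∷ 2F ∷ 4F ∷ 3F ∷ [])
    ∷ (2F ∷ 0F ∷ 3F ∷ 1F ∷ 4F ∷ 4F ∷ 1F ∷ 3F ∷ 5F ∷ 2F ∷ 4F ∷ 3F ∷ 5F ∷ 3F ∷ 0F ∷ 1F ∷ 2F ∷ 5F ∷ 1F ∷ 5F ∷ 0F ∷ 4F ∷ 0F ∷ 2F ∷ 3F ∷ [])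
    ∷ (0F ∷ 1F ∷ 4F ∷ 3F ∷ 2F ∷ 1F ∷ 4F ∷ 3F ∷ 2F ∷ 3F ∷ 5F ∷ 2F ∷ 4F ∷ 0F ∷ 2F ∷ 5F ∷ 2F ∷ 1F ∷ 3F ∷ 5F ∷ 1F ∷ 0F ∷ 5F ∷ 4F ∷ 0F ∷ [])
    ∷ (1F ∷ 0F ∷ 5F ∷ 2F ∷ 3F ∷ 0F ∷ 5F ∷ 2F ∷ 4F ∷ 1F ∷ 2F ∷ 5F ∷ 4F ∷ 2F ∷ 5F ∷ 3F ∷ 4F ∷ 3F ∷ 1F ∷ 3F ∷ 1F ∷ 4F ∷ 0F ∷ 0F ∷ 2F ∷ [])
    ∷ (5F ∷ 4F ∷ 0F ∷ 2F ∷ 3F ∷ 4F ∷ 1F ∷ 2F ∷ 3F ∷ 3F ∷ 2F ∷ 1F ∷ 0F ∷ 0F ∷ 1F ∷ 5F ∷ 4F ∷ 3F ∷ 1F ∷ 5F ∷ 2F ∷ 4F ∷ 5F ∷ 0F ∷ 4F ∷ [])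
    ∷ (1F ∷ 4F ∷ 2F ∷ 0F ∷ 5F ∷ 2F ∷ 3F ∷ 4F ∷ 5F ∷ 1F ∷ 3F ∷ 2F ∷ 0F ∷ 4F ∷ 0F ∷ 3F ∷ 5F ∷ 4F ∷ 1F ∷ 2F ∷ 0F ∷ 5F ∷ 3F ∷ 1F ∷ 4F ∷ [])
    ∷ (1F ∷ 2F ∷ 0F ∷ 4F ∷ 5F ∷ 0F ∷ 5F ∷ 4F ∷ 3F ∷ 5F ∷ 1F ∷ 3F ∷ 0F ∷ 2F ∷ 3F ∷ 1F ∷ 4F ∷ 5F ∷ 3F ∷ 1F ∷ 0F ∷ 0F ∷ 2F ∷ 5F ∷ 4F ∷ [])
    ∷ (4F ∷ 2F ∷ 1F ∷ 5F ∷ 0F ∷ 5F ∷ 2F ∷ 0F ∷ 1F ∷ 4F ∷ 0F ∷ 1F ∷ 3F ∷ 0F ∷ 1F ∷ 3F ∷ 4F ∷ 3F ∷ 5F ∷ 3F ∷ 5F ∷ 2F ∷ 4F ∷ 4F ∷ 2F ∷ [])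
    ∷ (3F ∷ 4F ∷ 2F ∷ 0F ∷ 5F ∷ 0F ∷ 2F ∷ 1F ∷ 4F ∷ 5F ∷ 1F ∷ 3F ∷ 2F ∷ 4F ∷ 3F ∷ 1F ∷ 0F ∷ 5F ∷ 4F ∷ 5F ∷ 3F ∷ 4F ∷ 1F ∷ 2F ∷ 0F ∷ [])
    ∷ (4F ∷ 3F ∷ 1F ∷ 0F ∷ 5F ∷ 2F ∷ 1F ∷ 3F ∷ 5F ∷ 0F ∷ 4F ∷ 2F ∷ 1F ∷ 5F ∷ 4F ∷ 1F ∷ 2F ∷ 5F ∷ 3F ∷ 0F ∷ 4F ∷ 1F ∷ 4F ∷ 2F ∷ 0F ∷ [])
    ∷ (3F ∷ 5F ∷ 2F ∷ 0F ∷ 1F ∷ 5F ∷ 1F ∷ 0F ∷ 4F ∷ 1F ∷ 4F ∷ 3F ∷ 2F ∷ 4F ∷ 3F ∷ 0F ∷ 3F ∷ 1F ∷ 0F ∷ 5F ∷ 2F ∷ 2F ∷ 4F ∷ 1F ∷ 5F ∷ [])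
    ∷ (5F ∷ 3F ∷ 1F ∷ 0F ∷ 4F ∷ 3F ∷ 0F ∷ 1F ∷ 4F ∷ 2F ∷ 4F ∷ 5F ∷ 0F ∷ 1F ∷ 5F ∷ 0F ∷ 5F ∷ 3F ∷ 2F ∷ 4F ∷ 2F ∷ 2F ∷ 1F ∷ 3F ∷ 5F ∷ [])
    ∷ (4F ∷ 3F ∷ 5F ∷ 1F ∷ 0F ∷ 3F ∷ 1F ∷ 0F ∷ 2F ∷ 5F ∷ 1F ∷ 0F ∷ 2F ∷ 2F ∷ 1F ∷ 4F ∷ 3F ∷ 2F ∷ 4F ∷ 4F ∷ 0F ∷ 3F ∷ 5F ∷ 5F ∷ 3F ∷ [])
    ∷ (1F ∷ 5F ∷ 2F ∷ 3F ∷ 4F ∷ 5F ∷ 0F ∷ 2F ∷ 3F ∷ 1F ∷ 4F ∷ 2F ∷ 0F ∷ 3F ∷ 4F ∷ 2F ∷ 1F ∷ 0F ∷ 3F ∷ 5F ∷ 4F ∷ 1F ∷ 5F ∷ 0F ∷ 1F ∷ [])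
    ∷ (1F ∷ 3F ∷ 4F ∷ 0F ∷ 5F ∷ 2F ∷ 5F ∷ 0F ∷ 4F ∷ 0F ∷ 5F ∷ 4F ∷ 2F ∷ 3F ∷ 4F ∷ 5F ∷ 1F ∷ 2F ∷ 0F ∷ 2F ∷ 0F ∷ 3F ∷ 1F ∷ 1F ∷ 3F ∷ [])
    ∷ (4F ∷ 0F ∷ 3F ∷ 1F ∷ 5F ∷ 1F ∷ 2F ∷ 3F ∷ 0F ∷ 4F ∷ 5F ∷ 3F ∷ 2F ∷ 5F ∷ 0F ∷ 2F ∷ 0F ∷ 2F ∷ 1F ∷ 4F ∷ 3F ∷ 5F ∷ 0F ∷ 1F ∷ 4F ∷ [])
    ∷ (4F ∷ 0F ∷ 5F ∷ 1F ∷ 2F ∷ 2F ∷ 3F ∷ 0F ∷ 1F ∷ 3F ∷ 4F ∷ 2F ∷ 5F ∷ 4F ∷ 1F ∷ 5F ∷ 2F ∷ 3F ∷ 1F ∷ 5F ∷ 0F ∷ 4F ∷ 0F ∷ 2F ∷ 3F ∷ [])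
    ∷ (2F ∷ 3F ∷ 0F ∷ 4F ∷ 1F ∷ 5F ∷ 1F ∷ 4F ∷ 3F ∷ 0F ∷ 2F ∷ 5F ∷ 4F ∷ 3F ∷ 2F ∷ 4F ∷ 4F ∷ 1F ∷ 5F ∷ 5F ∷ 0F ∷ 0F ∷ 3F ∷ 1F ∷ 2F ∷ [])
    ∷ (0F ∷ 1F ∷ 4F ∷ 3F ∷ 5F ∷ 5F ∷ 1F ∷ 4F ∷ 3F ∷ 3F ∷ 5F ∷ 0F ∷ 4F ∷ 4F ∷ 0F ∷ 2F ∷ 2F ∷ 1F ∷ 3F ∷ 3F ∷ 5F ∷ 5F ∷ 2F ∷ 1F ∷ 0F ∷ [])
    ∷ (3F ∷ 4F ∷ 0F ∷ 5F ∷ 2F ∷ 5F ∷ 0F ∷ 1F ∷ 2F ∷ 1F ∷ 3F ∷ 2F ∷ 0F ∷ 4F ∷ 3F ∷ 0F ∷ 1F ∷ 4F ∷ 5F ∷ 2F ∷ 3F ∷ 0F ∷ 3F ∷ 4F ∷ 1F ∷ [])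
    ∷ (5F ∷ 2F ∷ 0F ∷ 4F ∷ 1F ∷ 2F ∷ 3F ∷ 1F ∷ 4F ∷ 0F ∷ 4F ∷ 1F ∷ 3F ∷ 1F ∷ 4F ∷ 5F ∷ 5F ∷ 3F ∷ 2F ∷ 0F ∷ 2F ∷ 2F ∷ 5F ∷ 3F ∷ 0F ∷ [])
    ∷ (5F ∷ 2F ∷ 4F ∷ 1F ∷ 0F ∷ 4F ∷ 1F ∷ 3F ∷ 2F ∷ 3F ∷ 1F ∷ 4F ∷ 5F ∷ 2F ∷ 5F ∷ 0F ∷ 3F ∷ 5F ∷ 2F ∷ 4F ∷ 5F ∷ 0F ∷ 3F ∷ 1F ∷ 4F ∷ [])
    ∷ (1F ∷ 3F ∷ 0F ∷ 5F ∷ 4F ∷ 5F ∷ 2F ∷ 0F ∷ 4F ∷ 2F ∷ 5F ∷ 1F ∷ 0F ∷ 0F ∷ 4F ∷ 1F ∷ 1F ∷ 4F ∷ 3F ∷ 5F ∷ 3F ∷ 3F ∷ 2F ∷ 2F ∷ 5F ∷ [])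
    ∷ (5F ∷ 4F ∷ 2F ∷ 3F ∷ 1F ∷ 1F ∷ 4F ∷ 3F ∷ 0F ∷ 0F ∷ 5F ∷ 2F ∷ 3F ∷ 3F ∷ 2F ∷ 5F ∷ 1F ∷ 4F ∷ 0F ∷ 5F ∷ 2F ∷ 0F ∷ 5F ∷ 1F ∷ 4F ∷ [])
    ∷ (2F ∷ 4F ∷ 1F ∷ 5F ∷ 0F ∷ 1F ∷ 5F ∷ 4F ∷ 0F ∷ 2F ∷ 5F ∷ 0F ∷ 3F ∷ 4F ∷ 0F ∷ 3F ∷ 0F ∷ 3F ∷ 4F ∷ 3F ∷ 2F ∷ 1F ∷ 2F ∷ 5F ∷ 1F ∷ [])
    ∷ (5F ∷ 2F ∷ 0F ∷ 3F ∷ 4F ∷ 2F ∷ 3F ∷ 4F ∷ 1F ∷ 1F ∷ 5F ∷ 4F ∷ 0F ∷ 5F ∷ 3F ∷ 0F ∷ 1F ∷ 2F ∷ 3F ∷ 2F ∷ 4F ∷ 0F ∷ 1F ∷ 5F ∷ 2F ∷ [])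
    ∷ (0F ∷ 1F ∷ 3F ∷ 4F ∷ 5F ∷ 4F ∷ 5F ∷ 1F ∷ 2F ∷ 3F ∷ 5F ∷ 0F ∷ 2F ∷ 1F ∷ 2F ∷ 0F ∷ 4F ∷ 2F ∷ 0F ∷ 0F ∷ 3F ∷ 3F ∷ 1F ∷ 5F ∷ 4F ∷ [])
    ∷ (3F ∷ 4F ∷ 5F ∷ 2F ∷ 0F ∷ 4F ∷ 5F ∷ 2F ∷ 1F ∷ 1F ∷ 0F ∷ 3F ∷ 2F ∷ 3F ∷ 0F ∷ 5F ∷ 2F ∷ 1F ∷ 3F ∷ 1F ∷ 0F ∷ 4F ∷ 5F ∷ 3F ∷ 4F ∷ [])
    ∷ (3F ∷ 4F ∷ 0F ∷ 5F ∷ 2F ∷ 0F ∷ 5F ∷ 1F ∷ 2F ∷ 1F ∷ 2F ∷ 3F ∷ 5F ∷ 2F ∷ 5F ∷ 4F ∷ 3F ∷ 1F ∷ 4F ∷ 4F ∷ 0F ∷ 2F ∷ 0F ∷ 3F ∷ 1F ∷ [])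
    ∷ (3F ∷ 1F ∷ 0F ∷ 5F ∷ 4F ∷ 2F ∷ 1F ∷ 5F ∷ 0F ∷ 5F ∷ 4F ∷ 0F ∷ 3F ∷ 3F ∷ 4F ∷ 1F ∷ 5F ∷ 3F ∷ 2F ∷ 0F ∷ 2F ∷ 2F ∷ 1F ∷ 3F ∷ 5F ∷ [])
    ∷ (4F ∷ 2F ∷ 1F ∷ 3F ∷ 0F ∷ 2F ∷ 5F ∷ 0F ∷ 1F ∷ 5F ∷ 3F ∷ 4F ∷ 1F ∷ 1F ∷ 3F ∷ 4F ∷ 4F ∷ 0F ∷ 5F ∷ 2F ∷ 0F ∷ 1F ∷ 2F ∷ 5F ∷ 3F ∷ [])
    ∷ (3F ∷ 5F ∷ 1F ∷ 2F ∷ 0F ∷ 5F ∷ 0F ∷ 4F ∷ 2F ∷ 2F ∷ 0F ∷ 4F ∷ 3F ∷ 1F ∷ 3F ∷ 0F ∷ 4F ∷ 5F ∷ 2F ∷ 5F ∷ 3F ∷ 0F ∷ 1F ∷ 1F ∷ 4F ∷ [])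
    ∷ (3F ∷ 2F ∷ 4F ∷ 0F ∷ 5F ∷ 5F ∷ 4F ∷ 1F ∷ 2F ∷ 1F ∷ 0F ∷ 5F ∷ 4F ∷ 3F ∷ 0F ∷ 4F ∷ 5F ∷ 1F ∷ 2F ∷ 2F ∷ 0F ∷ 4F ∷ 3F ∷ 5F ∷ 1F ∷ [])
    ∷ (1F ∷ 3F ∷ 5F ∷ 2F ∷ 4F ∷ 4F ∷ 0F ∷ 2F ∷ 3F ∷ 1F ∷ 0F ∷ 4F ∷ 5F ∷ 2F ∷ 5F ∷ 0F ∷ 1F ∷ 3F ∷ 2F ∷ 3F ∷ 5F ∷ 1F ∷ 0F ∷ 4F ∷ 1F ∷ [])
    ∷ (5F ∷ 1F ∷ 0F ∷ 4F ∷ 3F ∷ 0F ∷ 3F ∷ 1F ∷ 2F ∷ 4F ∷ 3F ∷ 0F ∷ 2F ∷ 5F ∷ 3F ∷ 1F ∷ 2F ∷ 5F ∷ 4F ∷ 0F ∷ 4F ∷ 2F ∷ 1F ∷ 5F ∷ 0F ∷ [])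
    ∷ (3F ∷ 2F ∷ 5F ∷ 0F ∷ 4F ∷ 5F ∷ 0F ∷ 2F ∷ 4F ∷ 1F ∷ 4F ∷ 3F ∷ 0F ∷ 4F ∷ 3F ∷ 2F ∷ 1F ∷ 2F ∷ 3F ∷ 5F ∷ 3F ∷ 1F ∷ 5F ∷ 0F ∷ 1F ∷ [])
    ∷ (0F ∷ 3F ∷ 1F ∷ 2F ∷ 5F ∷ 3F ∷ 4F ∷ 1F ∷ 5F ∷ 5F ∷ 2F ∷ 4F ∷ 0F ∷ 0F ∷ 2F ∷ 4F ∷ 3F ∷ 5F ∷ 4F ∷ 5F ∷ 2F ∷ 0F ∷ 3F ∷ 3F ∷ 1F ∷ [])
    ∷ (1F ∷ 0F ∷ 5F ∷ 4F ∷ 3F ∷ 5F ∷ 4F ∷ 0F ∷ 2F ∷ 3F ∷ 4F ∷ 5F ∷ 1F ∷ 2F ∷ 4F ∷ 1F ∷ 1F ∷ 3F ∷ 2F ∷ 5F ∷ 0F ∷ 2F ∷ 0F ∷ 3F ∷ 4F ∷ [])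
    ∷ (2F ∷ 5F ∷ 4F ∷ 3F ∷ 0F ∷ 3F ∷ 1F ∷ 4F ∷ 0F ∷ 2F ∷ 0F ∷ 1F ∷ 3F ∷ 0F ∷ 5F ∷ 4F ∷ 2F ∷ 5F ∷ 1F ∷ 3F ∷ 5F ∷ 2F ∷ 4F ∷ 1F ∷ 2F ∷ [])
    ∷ (3F ∷ 2F ∷ 4F ∷ 1F ∷ 0F ∷ 0F ∷ 4F ∷ 1F ∷ 2F ∷ 3F ∷ 1F ∷ 5F ∷ 4F ∷ 1F ∷ 2F ∷ 5F ∷ 0F ∷ 2F ∷ 5F ∷ 5F ∷ 3F ∷ 0F ∷ 3F ∷ 4F ∷ 1F ∷ [])
    ∷ (3F ∷ 2F ∷ 4F ∷ 0F ∷ 5F ∷ 2F ∷ 1F ∷ 4F ∷ 5F ∷ 0F ∷ 5F ∷ 3F ∷ 4F ∷ 5F ∷ 1F ∷ 3F ∷ 0F ∷ 2F ∷ 3F ∷ 3F ∷ 4F ∷ 5F ∷ 1F ∷ 0F ∷ 2F ∷ [])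
    ∷ (3F ∷ 1F ∷ 0F ∷ 4F ∷ 2F ∷ 0F ∷ 1F ∷ 2F ∷ 5F ∷ 2F ∷ 3F ∷ 0F ∷ 5F ∷ 3F ∷ 1F ∷ 4F ∷ 5F ∷ 2F ∷ 4F ∷ 4F ∷ 2F ∷ 5F ∷ 1F ∷ 0F ∷ 3F ∷ [])
    ∷ (3F ∷ 1F ∷ 5F ∷ 0F ∷ 2F ∷ 4F ∷ 1F ∷ 0F ∷ 5F ∷ 5F ∷ 0F ∷ 2F ∷ 3F ∷ 3F ∷ 1F ∷ 2F ∷ 2F ∷ 3F ∷ 4F ∷ 5F ∷ 4F ∷ 4F ∷ 1F ∷ 3F ∷ 0F ∷ [])
    ∷ (3F ∷ 2F ∷ 5F ∷ 0F ∷ 1F ∷ 1F ∷ 5F ∷ 0F ∷ 4F ∷ 4F ∷ 1F ∷ 5F ∷ 3F ∷ 0F ∷ 3F ∷ 5F ∷ 2F ∷ 3F ∷ 4F ∷ 4F ∷ 1F ∷ 1F ∷ 2F ∷ 2F ∷ 0F ∷ [])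
    ∷ (0F ∷ 2F ∷ 3F ∷ 1F ∷ 4F ∷ 1F ∷ 5F ∷ 4F ∷ 3F ∷ 5F ∷ 0F ∷ 4F ∷ 1F ∷ 2F ∷ 3F ∷ 0F ∷ 1F ∷ 5F ∷ 2F ∷ 0F ∷ 4F ∷ 2F ∷ 3F ∷ 1F ∷ 5F ∷ [])
    ∷ (2F ∷ 1F ∷ 3F ∷ 4F ∷ 0F ∷ 1F ∷ 0F ∷ 5F ∷ 3F ∷ 5F ∷ 4F ∷ 0F ∷ 3F ∷ 3F ∷ 0F ∷ 2F ∷ 1F ∷ 2F ∷ 5F ∷ 4F ∷ 5F ∷ 3F ∷ 1F ∷ 1F ∷ 4F ∷ [])
    ∷ (3F ∷ 0F ∷ 4F ∷ 1F ∷ 5F ∷ 0F ∷ 5F ∷ 4F ∷ 2F ∷ 2F ∷ 1F ∷ 3F ∷ 4F ∷ 1F ∷ 5F ∷ 4F ∷ 2F ∷ 5F ∷ 0F ∷ 3F ∷ 0F ∷ 0F ∷ 2F ∷ 1F ∷ 3F ∷ [])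
    ∷ (2F ∷ 1F ∷ 5F ∷ 0F ∷ 3F ∷ 1F ∷ 0F ∷ 5F ∷ 4F ∷ 3F ∷ 0F ∷ 5F ∷ 2F ∷ 4F ∷ 2F ∷ 0F ∷ 3F ∷ 2F ∷ 4F ∷ 1F ∷ 2F ∷ 4F ∷ 1F ∷ 3F ∷ 5F ∷ [])
    ∷ (3F ∷ 0F ∷ 2F ∷ 4F ∷ 1F ∷ 4F ∷ 1F ∷ 2F ∷ 5F ∷ 3F ∷ 5F ∷ 2F ∷ 4F ∷ 0F ∷ 5F ∷ 1F ∷ 3F ∷ 1F ∷ 0F ∷ 4F ∷ 2F ∷ 3F ∷ 5F ∷ 0F ∷ 3F ∷ [])
    ∷ (2F ∷ 5F ∷ 0F ∷ 1F ∷ 3F ∷ 5F ∷ 0F ∷ 4F ∷ 1F ∷ 0F ∷ 1F ∷ 4F ∷ 2F ∷ 1F ∷ 3F ∷ 4F ∷ 2F ∷ 5F ∷ 4F ∷ 5F ∷ 3F ∷ 2F ∷ 0F ∷ 0F ∷ 5F ∷ [])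
    ∷ (2F ∷ 5F ∷ 0F ∷ 3F ∷ 1F ∷ 1F ∷ 4F ∷ 3F ∷ 0F ∷ 4F ∷ 1F ∷ 0F ∷ 3F ∷ 2F ∷ 0F ∷ 3F ∷ 3F ∷ 5F ∷ 2F ∷ 5F ∷ 1F ∷ 1F ∷ 4F ∷ 2F ∷ 5F ∷ [])
    ∷ (5F ∷ 1F ∷ 4F ∷ 3F ∷ 0F ∷ 2F ∷ 1F ∷ 0F ∷ 4F ∷ 5F ∷ 3F ∷ 2F ∷ 4F ∷ 0F ∷ 1F ∷ 3F ∷ 5F ∷ 1F ∷ 2F ∷ 3F ∷ 2F ∷ 4F ∷ 5F ∷ 5F ∷ 1F ∷ [])
    ∷ (0F ∷ 4F ∷ 1F ∷ 3F ∷ 5F ∷ 2F ∷ 5F ∷ 3F ∷ 4F ∷ 0F ∷ 2F ∷ 1F ∷ 3F ∷ 1F ∷ 5F ∷ 3F ∷ 3F ∷ 5F ∷ 0F ∷ 4F ∷ 0F ∷ 2F ∷ 4F ∷ 1F ∷ 2F ∷ [])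
    ∷ (4F ∷ 0F ∷ 3F ∷ 5F ∷ 1F ∷ 1F ∷ 3F ∷ 0F ∷ 2F ∷ 3F ∷ 1F ∷ 2F ∷ 5F ∷ 4F ∷ 2F ∷ 5F ∷ 5F ∷ 0F ∷ 2F ∷ 1F ∷ 0F ∷ 3F ∷ 4F ∷ 4F ∷ 3F ∷ [])
    ∷ (2F ∷ 5F ∷ 0F ∷ 3F ∷ 4F ∷ 4F ∷ 1F ∷ 0F ∷ 3F ∷ 0F ∷ 2F ∷ 4F ∷ 3F ∷ 5F ∷ 2F ∷ 1F ∷ 4F ∷ 5F ∷ 1F ∷ 3F ∷ 0F ∷ 1F ∷ 0F ∷ 5F ∷ 2F ∷ [])
    ∷ (2F ∷ 5F ∷ 3F ∷ 0F ∷ 4F ∷ 3F ∷ 5F ∷ 4F ∷ 1F ∷ 4F ∷ 1F ∷ 2F ∷ 0F ∷ 2F ∷ 0F ∷ 5F ∷ 0F ∷ 5F ∷ 2F ∷ 1F ∷ 4F ∷ 3F ∷ 1F ∷ 2F ∷ 3F ∷ [])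
    ∷ (2F ∷ 5F ∷ 0F ∷ 4F ∷ 1F ∷ 5F ∷ 1F ∷ 4F ∷ 3F ∷ 4F ∷ 1F ∷ 0F ∷ 3F ∷ 0F ∷ 2F ∷ 1F ∷ 2F ∷ 3F ∷ 5F ∷ 3F ∷ 4F ∷ 1F ∷ 2F ∷ 5F ∷ 0F ∷ [])
    ∷ (4F ∷ 5F ∷ 1F ∷ 0F ∷ 3F ∷ 2F ∷ 5F ∷ 0F ∷ 1F ∷ 0F ∷ 3F ∷ 1F ∷ 4F ∷ 1F ∷ 4F ∷ 3F ∷ 0F ∷ 4F ∷ 2F ∷ 2F ∷ 4F ∷ 3F ∷ 5F ∷ 5F ∷ 0F ∷ [])
    ∷ (3F ∷ 4F ∷ 5F ∷ 1F ∷ 2F ∷ 0F ∷ 1F ∷ 5F ∷ 4F ∷ 3F ∷ 1F ∷ 0F ∷ 5F ∷ 4F ∷ 1F ∷ 2F ∷ 0F ∷ 2F ∷ 4F ∷ 2F ∷ 5F ∷ 4F ∷ 3F ∷ 3F ∷ 0F ∷ [])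
    ∷ (1F ∷ 3F ∷ 4F ∷ 0F ∷ 5F ∷ 5F ∷ 2F ∷ 3F ∷ 0F ∷ 0F ∷ 5F ∷ 2F ∷ 4F ∷ 1F ∷ 2F ∷ 3F ∷ 3F ∷ 1F ∷ 2F ∷ 0F ∷ 4F ∷ 4F ∷ 3F ∷ 5F ∷ 1F ∷ [])
    ∷ (1F ∷ 2F ∷ 5F ∷ 3F ∷ 4F ∷ 5F ∷ 4F ∷ 3F ∷ 0F ∷ 1F ∷ 4F ∷ 0F ∷ 5F ∷ 3F ∷ 2F ∷ 4F ∷ 2F ∷ 1F ∷ 0F ∷ 0F ∷ 5F ∷ 4F ∷ 2F ∷ 1F ∷ 3F ∷ [])
    ∷ (4F ∷ 1F ∷ 3F ∷ 0F ∷ 2F ∷ 5F ∷ 1F ∷ 2F ∷ 0F ∷ 4F ∷ 5F ∷ 2F ∷ 0F ∷ 3F ∷ 0F ∷ 2F ∷ 0F ∷ 4F ∷ 1F ∷ 4F ∷ 5F ∷ 5F ∷ 3F ∷ 3F ∷ 4F ∷ [])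
    ∷ (5F ∷ 2F ∷ 4F ∷ 3F ∷ 0F ∷ 1F ∷ 4F ∷ 0F ∷ 2F ∷ 0F ∷ 3F ∷ 4F ∷ 1F ∷ 5F ∷ 4F ∷ 3F ∷ 0F ∷ 1F ∷ 2F ∷ 3F ∷ 1F ∷ 2F ∷ 5F ∷ 5F ∷ 4F ∷ [])
    ∷ (1F ∷ 2F ∷ 5F ∷ 4F ∷ 3F ∷ 0F ∷ 5F ∷ 3F ∷ 2F ∷ 5F ∷ 0F ∷ 3F ∷ 1F ∷ 4F ∷ 2F ∷ 1F ∷ 2F ∷ 1F ∷ 4F ∷ 1F ∷ 3F ∷ 5F ∷ 0F ∷ 4F ∷ 5F ∷ [])
    ∷ (0F ∷ 5F ∷ 1F ∷ 3F ∷ 2F ∷ 5F ∷ 1F ∷ 2F ∷ 3F ∷ 4F ∷ 3F ∷ 1F ∷ 0F ∷ 3F ∷ 1F ∷ 2F ∷ 4F ∷ 2F ∷ 5F ∷ 0F ∷ 5F ∷ 5F ∷ 4F ∷ 4F ∷ 1F ∷ [])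
    ∷ (3F ∷ 0F ∷ 2F ∷ 4F ∷ 1F ∷ 2F ∷ 0F ∷ 5F ∷ 4F ∷ 3F ∷ 4F ∷ 5F ∷ 2F ∷ 4F ∷ 1F ∷ 5F ∷ 1F ∷ 3F ∷ 5F ∷ 3F ∷ 2F ∷ 2F ∷ 0F ∷ 0F ∷ 3F ∷ [])
    ∷ (1F ∷ 3F ∷ 0F ∷ 2F ∷ 4F ∷ 5F ∷ 0F ∷ 2F ∷ 3F ∷ 2F ∷ 1F ∷ 4F ∷ 5F ∷ 4F ∷ 1F ∷ 0F ∷ 5F ∷ 3F ∷ 2F ∷ 3F ∷ 2F ∷ 5F ∷ 0F ∷ 4F ∷ 1F ∷ [])
    ∷ (0F ∷ 1F ∷ 4F ∷ 3F ∷ 2F ∷ 2F ∷ 4F ∷ 5F ∷ 3F ∷ 3F ∷ 0F ∷ 4F ∷ 5F ∷ 5F ∷ 4F ∷ 1F ∷ 1F ∷ 2F ∷ 3F ∷ 3F ∷ 0F ∷ 0F ∷ 1F ∷ 2F ∷ 4F ∷ [])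
    ∷ (4F ∷ 3F ∷ 5F ∷ 2F ∷ 0F ∷ 1F ∷ 0F ∷ 3F ∷ 5F ∷ 0F ∷ 1F ∷ 4F ∷ 5F ∷ 3F ∷ 5F ∷ 2F ∷ 4F ∷ 3F ∷ 2F ∷ 2F ∷ 1F ∷ 0F ∷ 1F ∷ 4F ∷ 3F ∷ [])
    ∷ (5F ∷ 3F ∷ 0F ∷ 4F ∷ 2F ∷ 1F ∷ 3F ∷ 4F ∷ 0F ∷ 2F ∷ 4F ∷ 5F ∷ 1F ∷ 4F ∷ 5F ∷ 3F ∷ 2F ∷ 1F ∷ 5F ∷ 0F ∷ 1F ∷ 3F ∷ 0F ∷ 2F ∷ 4F ∷ [])
    ∷ (3F ∷ 4F ∷ 1F ∷ 2F ∷ 5F ∷ 4F ∷ 1F ∷ 0F ∷ 5F ∷ 5F ∷ 0F ∷ 1F ∷ 2F ∷ 0F ∷ 1F ∷ 2F ∷ 3F ∷ 5F ∷ 4F ∷ 2F ∷ 4F ∷ 4F ∷ 3F ∷ 3F ∷ 0F ∷ [])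
    ∷ (2F ∷ 3F ∷ 1F ∷ 4F ∷ 5F ∷ 3F ∷ 0F ∷ 4F ∷ 1F ∷ 4F ∷ 5F ∷ 1F ∷ 0F ∷ 5F ∷ 2F ∷ 0F ∷ 3F ∷ 2F ∷ 4F ∷ 1F ∷ 4F ∷ 5F ∷ 3F ∷ 3F ∷ 2F ∷ [])
    ∷ (2F ∷ 4F ∷ 3F ∷ 0F ∷ 5F ∷ 5F ∷ 1F ∷ 0F ∷ 3F ∷ 3F ∷ 1F ∷ 5F ∷ 2F ∷ 4F ∷ 1F ∷ 0F ∷ 2F ∷ 4F ∷ 0F ∷ 3F ∷ 5F ∷ 2F ∷ 3F ∷ 4F ∷ 1F ∷ [])
    ∷ (5F ∷ 4F ∷ 1F ∷ 3F ∷ 0F ∷ 2F ∷ 1F ∷ 4F ∷ 3F ∷ 5F ∷ 3F ∷ 0F ∷ 1F ∷ 4F ∷ 1F ∷ 0F ∷ 2F ∷ 4F ∷ 5F ∷ 0F ∷ 5F ∷ 5F ∷ 2F ∷ 2F ∷ 4F ∷ [])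
    ∷ (5F ∷ 3F ∷ 4F ∷ 1F ∷ 0F ∷ 0F ∷ 2F ∷ 1F ∷ 3F ∷ 1F ∷ 2F ∷ 5F ∷ 4F ∷ 4F ∷ 3F ∷ 5F ∷ 3F ∷ 0F ∷ 5F ∷ 5F ∷ 0F ∷ 4F ∷ 2F ∷ 2F ∷ 1F ∷ [])
    ∷ (2F ∷ 4F ∷ 5F ∷ 1F ∷ 0F ∷ 3F ∷ 5F ∷ 1F ∷ 0F ∷ 2F ∷ 3F ∷ 0F ∷ 1F ∷ 4F ∷ 0F ∷ 5F ∷ 0F ∷ 2F ∷ 4F ∷ 2F ∷ 1F ∷ 5F ∷ 3F ∷ 4F ∷ 2F ∷ [])
    ∷ (3F ∷ 4F ∷ 5F ∷ 0F ∷ 2F ∷ 1F ∷ 0F ∷ 2F ∷ 5F ∷ 5F ∷ 3F ∷ 1F ∷ 0F ∷ 2F ∷ 4F ∷ 0F ∷ 1F ∷ 2F ∷ 4F ∷ 5F ∷ 4F ∷ 3F ∷ 5F ∷ 1F ∷ 3F ∷ [])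
    ∷ (2F ∷ 5F ∷ 4F ∷ 3F ∷ 1F ∷ 3F ∷ 0F ∷ 1F ∷ 4F ∷ 2F ∷ 3F ∷ 1F ∷ 4F ∷ 1F ∷ 4F ∷ 0F ∷ 5F ∷ 2F ∷ 0F ∷ 2F ∷ 3F ∷ 0F ∷ 5F ∷ 5F ∷ 2F ∷ [])
    ∷ (0F ∷ 3F ∷ 1F ∷ 5F ∷ 2F ∷ 2F ∷ 1F ∷ 5F ∷ 4F ∷ 0F ∷ 5F ∷ 2F ∷ 4F ∷ 4F ∷ 3F ∷ 5F ∷ 2F ∷ 4F ∷ 0F ∷ 0F ∷ 3F ∷ 1F ∷ 3F ∷ 2F ∷ 1F ∷ [])
    ∷ (2F ∷ 0F ∷ 3F ∷ 4F ∷ 5F ∷ 1F ∷ 5F ∷ 0F ∷ 4F ∷ 2F ∷ 5F ∷ 3F ∷ 4F ∷ 3F ∷ 4F ∷ 5F ∷ 2F ∷ 0F ∷ 1F ∷ 1F ∷ 0F ∷ 5F ∷ 2F ∷ 2F ∷ 3F ∷ [])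
    ∷ (1F ∷ 3F ∷ 2F ∷ 5F ∷ 0F ∷ 3F ∷ 0F ∷ 4F ∷ 2F ∷ 2F ∷ 4F ∷ 0F ∷ 5F ∷ 4F ∷ 1F ∷ 0F ∷ 5F ∷ 3F ∷ 1F ∷ 3F ∷ 1F ∷ 2F ∷ 4F ∷ 5F ∷ 3F ∷ [])
    ∷ (2F ∷ 5F ∷ 0F ∷ 4F ∷ 3F ∷ 1F ∷ 4F ∷ 5F ∷ 3F ∷ 4F ∷ 3F ∷ 0F ∷ 2F ∷ 3F ∷ 2F ∷ 0F ∷ 2F ∷ 5F ∷ 4F ∷ 0F ∷ 1F ∷ 3F ∷ 1F ∷ 4F ∷ 5F ∷ [])
    ∷ (1F ∷ 2F ∷ 0F ∷ 3F ∷ 4F ∷ 5F ∷ 3F ∷ 4F ∷ 2F ∷ 4F ∷ 5F ∷ 0F ∷ 1F ∷ 1F ∷ 2F ∷ 0F ∷ 2F ∷ 1F ∷ 3F ∷ 0F ∷ 4F ∷ 5F ∷ 2F ∷ 3F ∷ 5F ∷ [])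
    ∷ (5F ∷ 0F ∷ 4F ∷ 3F ∷ 2F ∷ 1F ∷ 4F ∷ 3F ∷ 0F ∷ 3F ∷ 2F ∷ 5F ∷ 4F ∷ 2F ∷ 5F ∷ 4F ∷ 3F ∷ 1F ∷ 5F ∷ 1F ∷ 5F ∷ 4F ∷ 0F ∷ 2F ∷ 1F ∷ [])
    ∷ (1F ∷ 4F ∷ 0F ∷ 2F ∷ 3F ∷ 5F ∷ 3F ∷ 4F ∷ 2F ∷ 3F ∷ 2F ∷ 1F ∷ 5F ∷ 2F ∷ 0F ∷ 1F ∷ 5F ∷ 3F ∷ 1F ∷ 1F ∷ 4F ∷ 5F ∷ 4F ∷ 3F ∷ 0F ∷ [])
    ∷ (0F ∷ 2F ∷ 5F ∷ 3F ∷ 4F ∷ 2F ∷ 5F ∷ 3F ∷ 1F ∷ 5F ∷ 3F ∷ 4F ∷ 1F ∷ 4F ∷ 1F ∷ 0F ∷ 2F ∷ 1F ∷ 0F ∷ 0F ∷ 3F ∷ 2F ∷ 5F ∷ 5F ∷ 2F ∷ [])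
    ∷ (1F ∷ 4F ∷ 2F ∷ 3F ∷ 0F ∷ 4F ∷ 3F ∷ 5F ∷ 2F ∷ 1F ∷ 3F ∷ 0F ∷ 5F ∷ 2F ∷ 3F ∷ 0F ∷ 4F ∷ 5F ∷ 1F ∷ 0F ∷ 5F ∷ 2F ∷ 4F ∷ 1F ∷ 3F ∷ [])
    ∷ (4F ∷ 0F ∷ 2F ∷ 1F ∷ 5F ∷ 5F ∷ 2F ∷ 0F ∷ 3F ∷ 1F ∷ 3F ∷ 5F ∷ 2F ∷ 0F ∷ 3F ∷ 4F ∷ 4F ∷ 0F ∷ 1F ∷ 1F ∷ 5F ∷ 4F ∷ 3F ∷ 2F ∷ 0F ∷ [])
    ∷ (1F ∷ 5F ∷ 4F ∷ 3F ∷ 0F ∷ 0F ∷ 2F ∷ 5F ∷ 3F ∷ 2F ∷ 1F ∷ 0F ∷ 4F ∷ 3F ∷ 1F ∷ 5F ∷ 5F ∷ 2F ∷ 3F ∷ 0F ∷ 4F ∷ 4F ∷ 5F ∷ 2F ∷ 1F ∷ [])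
    ∷ (0F ∷ 1F ∷ 2F ∷ 5F ∷ 3F ∷ 4F ∷ 5F ∷ 3F ∷ 1F ∷ 0F ∷ 5F ∷ 3F ∷ 4F ∷ 2F ∷ 5F ∷ 3F ∷ 0F ∷ 4F ∷ 1F ∷ 1F ∷ 4F ∷ 2F ∷ 0F ∷ 0F ∷ 5F ∷ [])
    ∷ (1F ∷ 5F ∷ 0F ∷ 4F ∷ 3F ∷ 2F ∷ 5F ∷ 0F ∷ 4F ∷ 4F ∷ 2F ∷ 3F ∷ 0F ∷ 3F ∷ 5F ∷ 1F ∷ 1F ∷ 5F ∷ 4F ∷ 4F ∷ 2F ∷ 1F ∷ 2F ∷ 3F ∷ 5F ∷ [])
    ∷ (2F ∷ 1F ∷ 4F ∷ 5F ∷ 0F ∷ 3F ∷ 1F ∷ 5F ∷ 0F ∷ 0F ∷ 2F ∷ 4F ∷ 5F ∷ 4F ∷ 2F ∷ 5F ∷ 5F ∷ 0F ∷ 3F ∷ 3F ∷ 2F ∷ 1F ∷ 2F ∷ 4F ∷ 1F ∷ [])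
    ∷ (4F ∷ 5F ∷ 2F ∷ 3F ∷ 0F ∷ 2F ∷ 5F ∷ 1F ∷ 0F ∷ 0F ∷ 4F ∷ 1F ∷ 3F ∷ 4F ∷ 3F ∷ 1F ∷ 0F ∷ 5F ∷ 1F ∷ 2F ∷ 3F ∷ 0F ∷ 2F ∷ 4F ∷ 5F ∷ [])
    ∷ (5F ∷ 2F ∷ 0F ∷ 3F ∷ 4F ∷ 4F ∷ 2F ∷ 3F ∷ 1F ∷ 3F ∷ 4F ∷ 1F ∷ 5F ∷ 1F ∷ 0F ∷ 5F ∷ 5F ∷ 2F ∷ 1F ∷ 4F ∷ 0F ∷ 5F ∷ 0F ∷ 2F ∷ 3F ∷ [])
    ∷ (2F ∷ 5F ∷ 4F ∷ 0F ∷ 3F ∷ 5F ∷ 4F ∷ 3F ∷ 1F ∷ 4F ∷ 3F ∷ 2F ∷ 1F ∷ 1F ∷ 0F ∷ 2F ∷ 0F ∷ 5F ∷ 2F ∷ 2F ∷ 3F ∷ 1F ∷ 4F ∷ 4F ∷ 5F ∷ [])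
    ∷ (3F ∷ 1F ∷ 0F ∷ 5F ∷ 4F ∷ 2F ∷ 1F ∷ 0F ∷ 4F ∷ 4F ∷ 3F ∷ 2F ∷ 5F ∷ 0F ∷ 5F ∷ 3F ∷ 5F ∷ 1F ∷ 2F ∷ 3F ∷ 2F ∷ 4F ∷ 3F ∷ 1F ∷ 0F ∷ [])
    ∷ (4F ∷ 1F ∷ 2F ∷ 5F ∷ 0F ∷ 2F ∷ 0F ∷ 3F ∷ 1F ∷ 3F ∷ 5F ∷ 0F ∷ 4F ∷ 4F ∷ 0F ∷ 5F ∷ 3F ∷ 4F ∷ 1F ∷ 5F ∷ 2F ∷ 1F ∷ 2F ∷ 4F ∷ 3F ∷ [])
    ∷ (2F ∷ 3F ∷ 0F ∷ 5F ∷ 1F ∷ 5F ∷ 3F ∷ 4F ∷ 0F ∷ 4F ∷ 1F ∷ 2F ∷ 0F ∷ 2F ∷ 3F ∷ 1F ∷ 5F ∷ 4F ∷ 2F ∷ 0F ∷ 4F ∷ 1F ∷ 3F ∷ 2F ∷ 5F ∷ [])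
    ∷ (4F ∷ 2F ∷ 0F ∷ 3F ∷ 1F ∷ 0F ∷ 3F ∷ 5F ∷ 2F ∷ 1F ∷ 4F ∷ 5F ∷ 0F ∷ 5F ∷ 4F ∷ 3F ∷ 2F ∷ 1F ∷ 3F ∷ 1F ∷ 4F ∷ 2F ∷ 4F ∷ 0F ∷ 5F ∷ [])
    ∷ (3F ∷ 5F ∷ 0F ∷ 4F ∷ 1F ∷ 2F ∷ 1F ∷ 4F ∷ 0F ∷ 3F ∷ 4F ∷ 1F ∷ 0F ∷ 4F ∷ 0F ∷ 1F ∷ 5F ∷ 3F ∷ 2F ∷ 3F ∷ 2F ∷ 2F ∷ 5F ∷ 5F ∷ 4F ∷ [])
    ∷ (0F ∷ 4F ∷ 1F ∷ 3F ∷ 2F ∷ 1F ∷ 5F ∷ 3F ∷ 2F ∷ 5F ∷ 0F ∷ 1F ∷ 3F ∷ 2F ∷ 4F ∷ 3F ∷ 3F ∷ 4F ∷ 5F ∷ 1F ∷ 4F ∷ 2F ∷ 0F ∷ 0F ∷ 1F ∷ [])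
    ∷ (5F ∷ 0F ∷ 1F ∷ 3F ∷ 4F ∷ 3F ∷ 1F ∷ 0F ∷ 2F ∷ 2F ∷ 3F ∷ 4F ∷ 1F ∷ 4F ∷ 5F ∷ 0F ∷ 2F ∷ 0F ∷ 5F ∷ 3F ∷ 5F ∷ 1F ∷ 2F ∷ 4F ∷ 3F ∷ [])
    ∷ (3F ∷ 4F ∷ 2F ∷ 5F ∷ 0F ∷ 0F ∷ 2F ∷ 4F ∷ 5F ∷ 3F ∷ 5F ∷ 2F ∷ 1F ∷ 5F ∷ 2F ∷ 1F ∷ 4F ∷ 0F ∷ 3F ∷ 1F ∷ 3F ∷ 3F ∷ 4F ∷ 0F ∷ 2F ∷ [])
    ∷ (4F ∷ 0F ∷ 2F ∷ 1F ∷ 5F ∷ 1F ∷ 2F ∷ 3F ∷ 5F ∷ 4F ∷ 5F ∷ 2F ∷ 3F ∷ 3F ∷ 5F ∷ 0F ∷ 1F ∷ 3F ∷ 4F ∷ 0F ∷ 4F ∷ 4F ∷ 0F ∷ 2F ∷ 1F ∷ [])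
    ∷ (4F ∷ 2F ∷ 0F ∷ 5F ∷ 3F ∷ 3F ∷ 5F ∷ 2F ∷ 1F ∷ 4F ∷ 5F ∷ 1F ∷ 0F ∷ 0F ∷ 1F ∷ 2F ∷ 2F ∷ 4F ∷ 1F ∷ 4F ∷ 3F ∷ 3F ∷ 2F ∷ 0F ∷ 5F ∷ [])
    ∷ (2F ∷ 5F ∷ 3F ∷ 4F ∷ 0F ∷ 1F ∷ 0F ∷ 3F ∷ 5F ∷ 4F ∷ 2F ∷ 0F ∷ 1F ∷ 3F ∷ 5F ∷ 2F ∷ 5F ∷ 1F ∷ 4F ∷ 4F ∷ 1F ∷ 2F ∷ 5F ∷ 0F ∷ 3F ∷ [])
    ∷ (4F ∷ 2F ∷ 3F ∷ 0F ∷ 1F ∷ 0F ∷ 5F ∷ 2F ∷ 3F ∷ 5F ∷ 1F ∷ 3F ∷ 4F ∷ 1F ∷ 4F ∷ 2F ∷ 2F ∷ 4F ∷ 5F ∷ 3F ∷ 4F ∷ 1F ∷ 2F ∷ 5F ∷ 0F ∷ [])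
    ∷ (5F ∷ 1F ∷ 3F ∷ 4F ∷ 2F ∷ 0F ∷ 1F ∷ 4F ∷ 3F ∷ 4F ∷ 2F ∷ 5F ∷ 0F ∷ 3F ∷ 1F ∷ 5F ∷ 4F ∷ 0F ∷ 5F ∷ 5F ∷ 2F ∷ 2F ∷ 1F ∷ 0F ∷ 4F ∷ [])
    ∷ (2F ∷ 5F ∷ 4F ∷ 3F ∷ 0F ∷ 5F ∷ 4F ∷ 0F ∷ 1F ∷ 2F ∷ 1F ∷ 4F ∷ 3F ∷ 1F ∷ 4F ∷ 0F ∷ 5F ∷ 0F ∷ 2F ∷ 2F ∷ 3F ∷ 1F ∷ 5F ∷ 5F ∷ 4F ∷ [])
    ∷ (1F ∷ 2F ∷ 0F ∷ 5F ∷ 4F ∷ 2F ∷ 0F ∷ 3F ∷ 4F ∷ 0F ∷ 5F ∷ 4F ∷ 3F ∷ 5F ∷ 4F ∷ 1F ∷ 4F ∷ 3F ∷ 1F ∷ 2F ∷ 3F ∷ 1F ∷ 2F ∷ 0F ∷ 5F ∷ [])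
    ∷ (2F ∷ 5F ∷ 4F ∷ 0F ∷ 1F ∷ 5F ∷ 4F ∷ 1F ∷ 3F ∷ 0F ∷ 3F ∷ 4F ∷ 2F ∷ 1F ∷ 4F ∷ 2F ∷ 2F ∷ 5F ∷ 0F ∷ 3F ∷ 0F ∷ 2F ∷ 3F ∷ 5F ∷ 4F ∷ [])
    ∷ (4F ∷ 2F ∷ 3F ∷ 5F ∷ 0F ∷ 3F ∷ 0F ∷ 5F ∷ 1F ∷ 0F ∷ 4F ∷ 1F ∷ 5F ∷ 4F ∷ 1F ∷ 2F ∷ 1F ∷ 0F ∷ 2F ∷ 3F ∷ 5F ∷ 4F ∷ 3F ∷ 0F ∷ 4F ∷ [])
    ∷ (5F ∷ 4F ∷ 1F ∷ 3F ∷ 2F ∷ 4F ∷ 0F ∷ 2F ∷ 3F ∷ 1F ∷ 3F ∷ 5F ∷ 0F ∷ 3F ∷ 0F ∷ 5F ∷ 4F ∷ 2F ∷ 5F ∷ 5F ∷ 2F ∷ 4F ∷ 1F ∷ 1F ∷ 4F ∷ [])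
    ∷ (3F ∷ 1F ∷ 0F ∷ 5F ∷ 2F ∷ 4F ∷ 5F ∷ 2F ∷ 1F ∷ 2F ∷ 5F ∷ 4F ∷ 3F ∷ 1F ∷ 5F ∷ 0F ∷ 4F ∷ 3F ∷ 1F ∷ 0F ∷ 3F ∷ 1F ∷ 0F ∷ 4F ∷ 5F ∷ [])
    ∷ (3F ∷ 2F ∷ 0F ∷ 1F ∷ 4F ∷ 5F ∷ 2F ∷ 4F ∷ 0F ∷ 3F ∷ 5F ∷ 0F ∷ 1F ∷ 1F ∷ 2F ∷ 4F ∷ 3F ∷ 4F ∷ 2F ∷ 0F ∷ 5F ∷ 3F ∷ 5F ∷ 1F ∷ 3F ∷ [])
    ∷ (5F ∷ 4F ∷ 2F ∷ 3F ∷ 0F ∷ 4F ∷ 2F ∷ 3F ∷ 0F ∷ 5F ∷ 3F ∷ 0F ∷ 1F ∷ 1F ∷ 2F ∷ 3F ∷ 0F ∷ 5F ∷ 4F ∷ 5F ∷ 4F ∷ 4F ∷ 2F ∷ 1F ∷ 5F ∷ [])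
    ∷ (2F ∷ 3F ∷ 5F ∷ 4F ∷ 0F ∷ 5F ∷ 3F ∷ 4F ∷ 1F ∷ 4F ∷ 1F ∷ 2F ∷ 5F ∷ 0F ∷ 2F ∷ 3F ∷ 2F ∷ 0F ∷ 3F ∷ 1F ∷ 5F ∷ 3F ∷ 1F ∷ 0F ∷ 4F ∷ [])
    ∷ (4F ∷ 3F ∷ 5F ∷ 0F ∷ 2F ∷ 2F ∷ 5F ∷ 0F ∷ 1F ∷ 5F ∷ 4F ∷ 2F ∷ 1F ∷ 3F ∷ 1F ∷ 0F ∷ 0F ∷ 1F ∷ 3F ∷ 4F ∷ 2F ∷ 3F ∷ 5F ∷ 5F ∷ 4F ∷ [])
    ∷ []

  catalog-nonempty : ∃ λ f → f ∈ catalog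
  catalog-nonempty = _ , here refl

catalog-properᵇ : Bool
catalog-properᵇ = allFinᵇ λ k → allFinᵇ λ l →
  conflictᵇ k l ⇒ᵇ all (λ f → not (lookup f k ≡ᵇ lookup f l)) catalog

opaque
  unfolding allFinᵇ catalog

  catalog-properᵇ-holds : catalog-properᵇ ≡ true
  catalog-properᵇ-holds = refl

catalog-proper : ∀ {f} → f ∈ catalog → IsProperIndexColoring (lookup f)
catalog-proper f∈ k l conflict =
  ≡ᵇ-false⇒≢ (All.lookup (All.all⁺ (λ f → not (lookup f k ≡ᵇ lookup f l)) catalog apart) f∈)
  where
  apart = ⇒ᵇ-elim (allFinᵇ-sound (allFinᵇ-sound (Equivalence.from T-≡ catalog-properᵇ-holds) k) l)
                  (proj₂ (conflictᵇ-correct k l) conflict)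

-- The exhaustive check

okᵇ : (same conflicting equal : Bool) → Bool
okᵇ same conflicting equal = (same ⇒ᵇ equal) ∧ (conflicting ⇒ᵇ not equal)

compatibleᵇ : Vec (Bool × Bool) 6 → Vec Bool 6 → Bool
compatibleᵇ tests equalities = Vec.foldr _ _∧_ true (Vec.zipWith (uncurry okᵇ) tests equalities)

patternᵇ : Vec (Bool × Bool) 6 → List (Vec Bool 6) → Vec Bool 6 → Bool
patternᵇ tests rows equalities = compatibleᵇ tests equalities ⇒ᵇ any (_≐ equalities) rows

conflictTable : Vec (Vec Bool 25) 25
conflictTable = tabulate λ k → tabulate (conflictᵇ k)

lookup-conflictTable : ∀ k l → lookup (lookup conflictTable k) l ≡ conflictᵇ k l
lookup-conflictTable k l =
  trans (cong (λ row → lookup row l) (lookup∘tabulate (tabulate ∘ conflictᵇ) k))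
        (lookup∘tabulate (conflictᵇ k) l)

pairTests : Vec (Vec Bool 25) 25 → Vec (Fin 25) 4 → Vec (Bool × Bool) 6
pairTests conflicts ks = Vec.map (λ (k , l) → k ≡ᵇ l , lookup (lookup conflicts k) l) (pairs ks)

column : Fin 25 → List Color
column k = List.map (λ f → lookup f k) catalog

columns : Vec (List Color) 25
columns = tabulate column

zip₄ : List A → List A → List A → List A → List (Vec A 4)
zip₄ (a ∷ as) (b ∷ bs) (c ∷ cs) (d ∷ ds) = (a ∷ b ∷ c ∷ d ∷ []) ∷ zip₄ as bs cs ds
zip₄ _        _        _        _        = []

zip₄-columns : (fs : List (Vec A m)) (k₁ k₂ k₃ k₄ : Fin m) →
               zip₄ (List.map (λ f → lookup f k₁) fs) (List.map (λ f → lookup f k₂) fs)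
                    (List.map (λ f → lookup f k₃) fs) (List.map (λ f → lookup f k₄) fs)
               ≡ List.map (λ f → Vec.map (lookup f) (k₁ ∷ k₂ ∷ k₃ ∷ k₄ ∷ [])) fs
zip₄-columns []       _  _  _  _  = refl
zip₄-columns (f ∷ fs) k₁ k₂ k₃ k₄ = cong (_ ∷_) (zip₄-columns fs k₁ k₂ k₃ k₄)

rowsAt : Vec (List Color) 25 → Vec (Fin 25) 4 → List (Vec Color 4)
rowsAt cols (k₁ ∷ k₂ ∷ k₃ ∷ k₄ ∷ []) =
  zip₄ (lookup cols k₁) (lookup cols k₂) (lookup cols k₃) (lookup cols k₄)

rowsAt-columns : ∀ ks → rowsAt columns ks ≡ List.map (λ f → Vec.map (lookup f) ks) catalog
rowsAt-columns (k₁ ∷ k₂ ∷ k₃ ∷ k₄ ∷ [])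
  rewrite lookup∘tabulate column k₁ | lookup∘tabulate column k₂
        | lookup∘tabulate column k₃ | lookup∘tabulate column k₄
  = zip₄-columns catalog k₁ k₂ k₃ k₄

patternProfiles : List (Vec Bool 6)
patternProfiles = List.map profile canonicalPatterns

-- Evaluation is call-by-need, so arguments are computed only once: the tables for the whole
-- check, the tests and the row profiles once per quadruple.
quadrupleᵇ : Vec (Vec Bool 25) 25 → Vec (List Color) 25 → List (Vec Bool 6) → Vec (Fin 25) 4 → Bool
quadrupleᵇ conflicts cols patterns ks =
  all (patternᵇ (pairTests conflicts ks) (List.map profile (rowsAt cols ks))) patterns

quadruplesᵇ : Bool
quadruplesᵇ = check conflictTable columns patternProfiles
  where
  check : Vec (Vec Bool 25) 25 → Vec (List Color) 25 → List (Vec Bool 6) → Bool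
  check conflicts cols patterns =
    allFinᵇ λ k₁ → allFromᵇ k₁ λ k₂ → allFromᵇ k₂ λ k₃ → allFromᵇ k₃ λ k₄ →
    quadrupleᵇ conflicts cols patterns (k₁ ∷ k₂ ∷ k₃ ∷ k₄ ∷ [])

opaque
  unfolding allFinᵇ catalog

  quadruplesᵇ-holds : quadruplesᵇ ≡ true
  quadruplesᵇ-holds = refl

quadrupleᵇ-holds : (ks : Vec (Fin 25) 4) → Nondecreasing ks →
                   T (quadrupleᵇ conflictTable columns patternProfiles ks)
quadrupleᵇ-holds (k₁ ∷ k₂ ∷ k₃ ∷ k₄ ∷ []) (k₁≤k₂ , k₂≤k₃ , k₃≤k₄) =
  allFromᵇ-sound (allFromᵇ-sound (allFromᵇ-sound
    (allFinᵇ-sound (Equivalence.from T-≡ quadruplesᵇ-holds) k₁) k₁≤k₂) k₂≤k₃) k₃≤k₄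

okᵇ-intro : ∀ {k l} {c d : Fin n} → (k ≡ l → c ≡ d) → (Conflict k l → c ≢ d) →
            T (okᵇ (k ≡ᵇ l) (lookup (lookup conflictTable k) l) (c ≡ᵇ d))
okᵇ-intro {k = k} {l} {c} {d} same⇒equal conflict⇒distinct =
  subst (λ conflicting → T (okᵇ (k ≡ᵇ l) conflicting (c ≡ᵇ d))) (sym (lookup-conflictTable k l))
    (Equivalence.from T-∧ (⇒ᵇ-intro (≡⇒≡ᵇ ∘ same⇒equal ∘ ≡ᵇ⇒≡) ,
                           ⇒ᵇ-intro (≢⇒≡ᵇ-false ∘ conflict⇒distinct ∘ proj₁ (conflictᵇ-correct k l))))

admissible⇒compatible : (ks : Vec (Fin 25) 4) (cs : Vec Color 4) → Admissible ks cs →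
                        T (compatibleᵇ (pairTests conflictTable ks) (profile cs))
admissible⇒compatible (_ ∷ _ ∷ _ ∷ _ ∷ []) (_ ∷ _ ∷ _ ∷ _ ∷ []) adm =
  ok 0F 1F ∧⁺ ok 0F 2F ∧⁺ ok 0F 3F ∧⁺ ok 1F 2F ∧⁺ ok 1F 3F ∧⁺ ok 2F 3F ∧⁺ tt
  where
  infixr 2 _∧⁺_
  _∧⁺_ : ∀ {a b} → T a → T b → T (a ∧ b)
  x ∧⁺ y = Equivalence.from T-∧ (x , y)

  ok = λ i j → okᵇ-intro (proj₁ (adm i j)) (proj₂ (adm i j))

Realized : Vec (Fin 25) n → Vec A n → Set
Realized ks cs = Any.Any (λ f → SamePattern (Vec.map (lookup f) ks) cs) catalog

catalog-realizes : (ks : Vec (Fin 25) 4) → Nondecreasing ks → (cs : Vec Color 4) →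
                     Admissible ks cs → Realized ks cs
catalog-realizes ks sorted cs adm with patterns-complete cs
... | p , p∈ , cs∼p =
  Any.map (λ {f} same → profile⇒samePattern (Vec.map (lookup f) ks) cs (trans (≐⇒≡ same) (sym cs∼p)))
    (Any.map⁻ (subst (Any.Any (T ∘ (_≐ profile p) ∘ profile)) (rowsAt-columns ks) (Any.map⁻ found)))
  where
  rows = List.map profile (rowsAt columns ks)

  found : Any.Any (T ∘ (_≐ profile p)) rows
  found = any⁻ (_≐ profile p) rows
    (⇒ᵇ-elim (All.lookup (All.all⁺ (patternᵇ (pairTests conflictTable ks) rows) patternProfiles
                                   (quadrupleᵇ-holds ks sorted))
                         (∈-map⁺ profile p∈))
             (subst (T ∘ compatibleᵇ (pairTests conflictTable ks)) cs∼p (admissible⇒compatible ks cs adm)))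

record Padding (S : List (Fin n)) : Set where
  field
    tuple         : Vec (Fin n) 4
    nondecreasing : Nondecreasing tuple
    tuple⊆S       : VecAll.All (_∈ S) tuple
    S⊆tuple       : All (Vec._∈ tuple) S

padding : (x : Fin n) (xs : List (Fin n)) → AllPairs _<_ (x ∷ xs) → length xs ℕ.< 4 →
          Padding (x ∷ xs)
padding a [] _ _ = record
  { tuple = a ∷ a ∷ a ∷ a ∷ []
  ; nondecreasing = ≤-refl , ≤-refl , ≤-refl
  ; tuple⊆S = a∈ ∷ a∈ ∷ a∈ ∷ a∈ ∷ []
  ; S⊆tuple = here refl ∷ []
  }
  where a∈ = here refl
padding a (b ∷ []) ((a<b ∷ []) ∷ _) _ = record
  { tuple = a ∷ a ∷ a ∷ b ∷ []
  ; nondecreasing = ≤-refl , ≤-refl , ℕ.<⇒≤ a<b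
  ; tuple⊆S = a∈ ∷ a∈ ∷ a∈ ∷ b∈ ∷ []
  ; S⊆tuple = here refl ∷ there (there (there (here refl))) ∷ []
  }
  where a∈ = here refl ; b∈ = there (here refl)
padding a (b ∷ c ∷ []) ((a<b ∷ _) ∷ (b<c ∷ []) ∷ _) _ = record
  { tuple = a ∷ a ∷ b ∷ c ∷ []
  ; nondecreasing = ≤-refl , ℕ.<⇒≤ a<b , ℕ.<⇒≤ b<c
  ; tuple⊆S = a∈ ∷ a∈ ∷ b∈ ∷ c∈ ∷ []
  ; S⊆tuple = here refl ∷ there (there (here refl)) ∷ there (there (there (here refl))) ∷ []
  }
  where a∈ = here refl ; b∈ = there (here refl) ; c∈ = there (there (here refl))
padding a (b ∷ c ∷ d ∷ []) ((a<b ∷ _) ∷ (b<c ∷ _) ∷ (c<d ∷ []) ∷ _) _ = record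
  { tuple = a ∷ b ∷ c ∷ d ∷ []
  ; nondecreasing = ℕ.<⇒≤ a<b , ℕ.<⇒≤ b<c , ℕ.<⇒≤ c<d
  ; tuple⊆S = a∈ ∷ b∈ ∷ c∈ ∷ d∈ ∷ []
  ; S⊆tuple = here refl ∷ there (here refl) ∷ there (there (here refl))
              ∷ there (there (there (here refl))) ∷ []
  }
  where
  a∈ = here refl ; b∈ = there (here refl) ; c∈ = there (there (here refl))
  d∈ = there (there (there (here refl)))
padding _ (_ ∷ _ ∷ _ ∷ _ ∷ _) _ (s≤s (s≤s (s≤s (s≤s ()))))

-- Extending a precoloring

module Extension (φ : PartialColoring) (φ-proper : IsProperPartial φ) where

  Colored : Fin 25 → Set
  Colored k = Σ Color λ c → φ (edgeAt k) ≡ just c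

  colored? : Unary.Decidable Colored
  colored? k with φ (edgeAt k)
  ... | just c  = yes (c , refl)
  ... | nothing = no λ { (_ , ()) }

  color : Fin 25 → Color
  color k = fromMaybe zero (φ (edgeAt k))

  color-colored : ∀ {k c} → φ (edgeAt k) ≡ just c → color k ≡ c
  color-colored eq rewrite eq = refl

  color-proper : ∀ {k l} → Colored k → Colored l → Conflict k l → color k ≢ color l
  color-proper {k} {l} (c , φk≡c) (d , φl≡d) (k≢l , incident) same =
    proj₂ φ-proper (edgeAt k) (edgeAt l) c (edgeAt-injective k≢l) incident φk≡c (begin
      φ (edgeAt l)    ≡⟨ φl≡d ⟩
      just d          ≡⟨ cong just (color-colored φl≡d) ⟨
      just (color l)  ≡⟨ cong just same ⟨
      just (color k)  ≡⟨ cong just (color-colored φk≡c) ⟩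
      just c          ∎)

  color-admissible : (ks : Vec (Fin 25) n) → VecAll.All Colored ks → Admissible ks (Vec.map color ks)
  color-admissible ks colored i j =
    (λ ksᵢ≡ksⱼ → trans (lookup-map i color ks)
                   (trans (cong color ksᵢ≡ksⱼ) (sym (lookup-map j color ks)))) ,
    (λ conflict eq → color-proper (lookup⁺ colored i) (lookup⁺ colored j) conflict
                       (trans (sym (lookup-map i color ks)) (trans eq (lookup-map j color ks))))

  agreement⇒extendable : (g : Fin 25 → Color) → IsProperIndexColoring g →
                         (∀ k c → φ (edgeAt k) ≡ just c → g k ≡ c) → Extendable φ
  agreement⇒extendable g proper agrees =
    g ∘ indexOf ,
    properIndexColoring⇒properTotal proper ,
    λ e c φe≡c → agrees (indexOf e) c (trans (proj₁ φ-proper _ e (edgeAt-indexOf e)) φe≡c)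

  realized⇒extendable : {ks : Vec (Fin 25) n} → Realized ks (Vec.map color ks) →
                        (∀ {k} → Colored k → k Vec.∈ ks) → Extendable φ
  realized⇒extendable {ks = ks} realized covered with find realized
  ... | f , f∈ , same with samePattern⇒relabeling (Vec.map (lookup f) ks) (Vec.map color ks) same
  ...   | π , π-maps = agreement⇒extendable ((π ⟨$⟩ʳ_) ∘ lookup f)
                         (λ k l conflict → catalog-proper f∈ k l conflict ∘ permutation-injective π) agrees
    where
    agrees : ∀ k c → φ (edgeAt k) ≡ just c → π ⟨$⟩ʳ lookup f k ≡ c
    agrees k c φk≡c = begin
      π ⟨$⟩ʳ lookup f k                        ≡⟨ cong (λ k → π ⟨$⟩ʳ lookup f k) k≡ksᵢ ⟩
      π ⟨$⟩ʳ lookup f (lookup ks i)            ≡⟨ cong (π ⟨$⟩ʳ_) (lookup-map i (lookup f) ks) ⟨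
      π ⟨$⟩ʳ lookup (Vec.map (lookup f) ks) i  ≡⟨ π-maps i ⟩
      lookup (Vec.map color ks) i              ≡⟨ lookup-map i color ks ⟩
      color (lookup ks i)                      ≡⟨ cong color k≡ksᵢ ⟨
      color k                                  ≡⟨ color-colored φk≡c ⟩
      c                                        ∎
      where
      k∈ks = covered (c , φk≡c)
      i = VecAny.index k∈ks
      k≡ksᵢ = lookup-index k∈ks

  extendable-from-quadruple : (ks : Vec (Fin 25) 4) → Nondecreasing ks → VecAll.All Colored ks →
                              (∀ {k} → Colored k → k Vec.∈ ks) → Extendable φ
  extendable-from-quadruple ks sorted colored =
    realized⇒extendable (catalog-realizes ks sorted (Vec.map color ks) (color-admissible ks colored))

  extendable-from : (S : List (Fin 25)) → AllPairs _<_ S → length S ℕ.≤ 4 →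
                    (∀ {k} → k ∈ S → Colored k) → (∀ {k} → Colored k → k ∈ S) → Extendable φ
  extendable-from [] _ _ _ complete =
    realized⇒extendable {ks = []} (lose (proj₂ catalog-nonempty) λ ())
                        (λ colored → contradiction (complete colored) λ ())
  extendable-from (x ∷ xs) sorted short sound complete =
    extendable-from-quadruple tuple nondecreasing (VecAll.map sound tuple⊆S)
                              (All.lookup S⊆tuple ∘ complete)
    where open Padding {S = x ∷ xs} (padding x xs sorted short)

  coloredIndices : List (Fin 25)
  coloredIndices = filter colored? (allFin 25)

  coloredIndices-sorted : AllPairs _<_ coloredIndices
  coloredIndices-sorted = AllPairs.filter⁺ colored? (AllPairs.tabulate⁺-< λ i<j → i<j)

  coloredIndices-sound : ∀ {k} → k ∈ coloredIndices → Colored k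
  coloredIndices-sound = proj₂ ∘ ∈-filter⁻ colored?

  coloredIndices-complete : ∀ {k} → Colored k → k ∈ coloredIndices
  coloredIndices-complete = ∈-filter⁺ colored? (∈-allFin _)

  coloredIndices-length : AtMostColored 4 φ → length coloredIndices ℕ.≤ 4
  coloredIndices-length atMost = subst (ℕ._≤ 4) (length-map edgeAt coloredIndices)
    (atMost (List.map edgeAt coloredIndices)
            (AllPairs.map⁺ (AllPairs.map (edgeAt-injective ∘ <⇒≢) coloredIndices-sorted))
            (All.map⁺ (All.tabulate coloredIndices-sound)))

lemma2p9 : (φ : PartialColoring) → IsProperPartial φ → AtMostColored 4 φ →
    Extendable φ
lemma2p9 φ φ-proper atMost4 =
  extendable-from coloredIndices coloredIndices-sorted (coloredIndices-length atMost4)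
                  coloredIndices-sound coloredIndices-complete
  where open Extension φ φ-proper
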